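{- For any even $n\ge 6$ and any edge $e\in E(V_n)$, the inequality $x_e\le 1$ is facet-defining for $\textsc{Bond}(V_n)$.
   Context: For even $n$, the (generalized) Wagner graph $V_n$ is obtained from the cycle $C_n$ on vertices $1,\dots,n$ (in cyclic order) by adding the edges $\{i,i+\tfrac n2\}$ for $1\le i\le\tfrac n2$. For a graph $G=(V,E)$ and $S\subseteq V$, the cut $\delta(S)=\{e\in E:|e\cap S|=1\}$ is a bond if $G[S]$ and $G[V\setminus S]$ are connected. $x^\delta$ is the incidence vector, $\textsc{Bond}(G)=\mathrm{conv}\{x^\delta:\delta\text{ a bond}\}$.
   Formalization: The incidence vectors $x^\delta$ have rational coordinates, and the affine independence that fixes the dimensions of the polytope and of its face uses rational coefficients. -}

module Defs where

open import Data.Nat using (ℕ; zero; suc; _<_; _∸_) renaming (_+_ to _+ℕ_)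
open import Data.Nat.DivMod using (_/_)
open import Data.Fin using (Fin; toℕ) renaming (zero to fz; suc to fs)
open import Data.Bool using (Bool; T; not; _xor_)
open import Data.Product using (Σ; ∃; _×_; _,_; proj₁; proj₂)
open import Data.Sum using (_⊎_)
open import Data.Rational using (ℚ; 0ℚ; 1ℚ; _+_; _*_; _≤_)
open import Relation.Binary.PropositionalEquality using (_≡_)

-- The (generalized) Wagner graph V_n.
-- Vertex k+1 of the paper is represented by (k : Fin n), k = 0,…,n-1.

-- Arc i j : the pair {i,j} is an edge of V_n, seen from i.
--   cycle edges  {k, k+1}  and the closing edge {n-1, 0},
--   chords       {k, k + n/2}   (0 ≤ k < n/2, since k + n/2 < n).
Arc : (n : ℕ) → Fin n → Fin n → Set
Arc n i j =
  (toℕ j ≡ suc (toℕ i))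
  ⊎ ((toℕ i ≡ n ∸ 1 × toℕ j ≡ 0)
  ⊎ (toℕ j ≡ toℕ i +ℕ n / 2))

Adj : (n : ℕ) → Fin n → Fin n → Set
Adj n i j = Arc n i j ⊎ Arc n j i

Edge : ℕ → Set
Edge n = Σ (Fin n × Fin n) λ p → (toℕ (proj₁ p) < toℕ (proj₂ p)) × Adj n (proj₁ p) (proj₂ p)

Subset : ℕ → Set
Subset n = Fin n → Bool

-- Walks inside the induced subgraph G[S] (all vertices after the start lie in S)
data Reach {n : ℕ} (S : Subset n) : Fin n → Fin n → Set where
  here : ∀ {u} → Reach S u u
  step : ∀ {u w v} → Adj n u w → T (S w) → Reach S w v → Reach S u v

Connected : {n : ℕ} → Subset n → Set
Connected {n} S =
  (∃ λ u → T (S u)) × (∀ u v → T (S u) → T (S v) → Reach S u v)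

Complement : {n : ℕ} → Subset n → Subset n
Complement S i = not (S i)

cutVec : {n : ℕ} → Subset n → Edge n → ℚ
cutVec S ((i , j) , _) with S i xor S j
... | Bool.true = 1ℚ
... | Bool.false = 0ℚ

IsBondVec : (n : ℕ) → (Edge n → ℚ) → Set
IsBondVec n x =
  Σ (Subset n) λ S → Connected S × Connected (Complement S) × (∀ e → x e ≡ cutVec S e)

sumℚ : (k : ℕ) → (Fin k → ℚ) → ℚ
sumℚ zero f = 0ℚ
sumℚ (suc k) f = f fz + sumℚ k (λ i → f (fs i))

AffInd : {E : Set} {m : ℕ} → (Fin m → (E → ℚ)) → Set
AffInd {E} {m} v =
  (c : Fin m → ℚ) →
  sumℚ m c ≡ 0ℚ →
  (∀ e → sumℚ m (λ i → c i * v i e) ≡ 0ℚ) →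
  ∀ i → c i ≡ 0ℚ

AffDim : {E : Set} → ((E → ℚ) → Set) → ℕ → Set
AffDim {E} P d =
  (Σ (Fin (suc d) → (E → ℚ)) λ v → (∀ i → P (v i)) × AffInd v)
  × ((v : Fin (suc (suc d)) → (E → ℚ)) → (∀ i → P (v i)) → AffInd v → Data.Empty.⊥)
  where import Data.Empty

-- Facet-defining inequality x_e ≤ 1 for Bond(V_n) = conv{bond vectors}.
-- Valid on all vertices (hence on the polytope), and the face
-- F = Bond(V_n) ∩ {x_e = 1} = conv{bond vectors with x_e = 1}
-- has dimension dim Bond(V_n) - 1.

FacetDefining-xe≤1 : (n : ℕ) → Edge n → Set
FacetDefining-xe≤1 n e =
  (∀ x → IsBondVec n x → x e ≤ 1ℚ)
  × (Σ ℕ λ d → AffDim (IsBondVec n) (suc d)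
               × AffDim (λ x → IsBondVec n x × x e ≡ 1ℚ) d)

module Submission where

-- Cut vectors are 0/1-vectors, so x_e ≤ 1 is valid. For the dimensions it suffices to
-- exhibit, for an edge e = ab, |E| bonds separating a and b whose cut vectors are linearly
-- independent, and one bond not separating them: the polytope then has |E| + 1 affinely
-- independent vertices and the face x_e = 1 has |E|, while more cannot fit in ℚ^E (for the face,
-- because x_e = 1 on it). Rotations of V_n reduce this to e = {0, n - 1} and e = {0, h}, n = 2h.
-- For an edge uv not meeting e there are bonds S, S + u, S + v, S + u + v, all separating e,
-- whose cut vectors combine to -2 times the unit vector of uv; the five edges meeting e are
-- covered by five further bonds whose cut vectors, read on those five edges, form a unitriangular
-- matrix. Every bond used has shores made of at most three arcs of the cycle, joined by chords.

open import Defs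
open import Algebra.Bundles using (CommutativeRing)
open import Data.Bool using (Bool; true; false; T; _∧_; _∨_; _xor_; if_then_else_)
open import Data.Bool.Properties using (T-≡; T-∨; T-∧; T-not-≡; ∨-zeroʳ; ∧-zeroʳ; xor-comm)
open import Data.Bool.Solver using (module ∨-∧-Solver)
open import Data.Empty using (⊥; ⊥-elim)
open import Data.Fin as Fin
  using (Fin; zero; suc; toℕ; fromℕ<; punchIn; punchOut; inject₁; combine; remQuot; splitAt; join; _↑ˡ_; _↑ʳ_)
open import Data.Fin.Properties
  using (any?; toℕ-fromℕ<; toℕ-fromℕ; toℕ-injective; toℕ<n; toℕ-inject₁; toℕ-↑ˡ; toℕ-↑ʳ; punchIn-injective;
         punchOut-injective; punchIn-punchOut; punchInᵢ≢i; remQuot-combine; join-splitAt; splitAt-join)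
open import Data.Nat using (ℕ; zero; suc; pred; z≤n; s≤s; _≤_; _<_; _∸_; _<ᵇ_; _≤ᵇ_; _≡ᵇ_; _/_)
  renaming (_+_ to _+ℕ_; _*_ to _*ℕ_)
open import Data.Nat.DivMod using (m*n/n≡m)
open import Data.Nat.Divisibility using (_∣_; divides)
import Data.Nat.Properties as ℕ
open import Data.Product using (Σ; ∃; _×_; _,_; proj₁; proj₂; map)
open import Data.Rational using (ℚ; 0ℚ; 1ℚ; ½; -½; _+_; _*_; _-_; -_; 1/_; ≢-nonZero) renaming (_≤_ to _≤ℚ_)
import Data.Rational.Properties as ℚ
open import Data.Rational.Solver using (module +-*-Solver)
open import Data.Sum using (_⊎_; inj₁; inj₂; [_,_]′)
open import Data.Unit using (⊤; tt)
open import Data.Vec.Functional using (_++_; _∷_)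
open import Data.Vec.Functional.Properties using (lookup-++ˡ; lookup-++ʳ)
open import Function using (_∘_; id; Equivalence)
open import Function.Definitions using (Injective)
open import Relation.Binary.Definitions using (tri<; tri≈; tri>)
open import Relation.Binary.PropositionalEquality
  using (_≡_; _≢_; refl; sym; trans; cong; cong₂; subst; subst₂; module ≡-Reasoning)
open import Relation.Nullary using (¬_; Dec; does; yes; no; ¬?; contradiction)
open import Relation.Nullary.Decidable using (decidable-stable; dec-true; dec-false)

open import Algebra.Properties.Semiring.Sum (CommutativeRing.semiring ℚ.+-*-commutativeRing)
  using (sum; sum-syntax; sum-cong-≗; sum-replicate-zero; sum-remove; ∑-comm; ∑-distrib-+; *-distribˡ-sum; *-distribʳ-sum)
open ≡-Reasoning

private
  variable
    K L M N : ℕ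
    E : Set

sumℚ≡sum : ∀ k (f : Fin k → ℚ) → sumℚ k f ≡ sum f
sumℚ≡sum zero    f = refl
sumℚ≡sum (suc k) f = cong (f zero +_) (sumℚ≡sum k (f ∘ suc))

+-killˡ : {a b : ℚ} → a ≡ 0ℚ → a + b ≡ b
+-killˡ {b = b} refl = ℚ.+-identityˡ b

+-killʳ : {a b : ℚ} → b ≡ 0ℚ → a + b ≡ a
+-killʳ {a} refl = ℚ.+-identityʳ a

*-killˡ : {a b : ℚ} → a ≡ 0ℚ → a * b ≡ 0ℚ
*-killˡ {b = b} refl = ℚ.*-zeroˡ b

*-killʳ : {a b : ℚ} → b ≡ 0ℚ → a * b ≡ 0ℚ
*-killʳ {a} refl = ℚ.*-zeroʳ a

sum-zero : {f : Fin N → ℚ} → (∀ i → f i ≡ 0ℚ) → sum f ≡ 0ℚ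
sum-zero {N} f≡0 = trans (sum-cong-≗ f≡0) (sum-replicate-zero N)

unit : Fin N → Fin N → ℚ
unit j i = if does (j Fin.≟ i) then 1ℚ else 0ℚ

unit-diagonal : (j : Fin N) → unit j j ≡ 1ℚ
unit-diagonal j = cong (if_then 1ℚ else 0ℚ) (dec-true (j Fin.≟ j) refl)

unit-off-diagonal : {i j : Fin N} → j ≢ i → unit j i ≡ 0ℚ
unit-off-diagonal {i = i} {j} j≢i = cong (if_then 1ℚ else 0ℚ) (dec-false (j Fin.≟ i) j≢i)

sum-unit : (j : Fin N) (f : Fin N → ℚ) → ∑[ i < N ] (unit j i * f i) ≡ f j
sum-unit {suc N} j f = begin
  ∑[ i < suc N ] (unit j i * f i)                      ≡⟨ sum-remove {i = j} (λ i → unit j i * f i) ⟩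
  unit j j * f j + ∑[ i < N ] (unit j (punchIn j i) * f (punchIn j i))
    ≡⟨ cong₂ _+_ (cong (_* f j) (unit-diagonal j)) (sum-zero (λ i → *-killˡ (unit-off-diagonal (punchInᵢ≢i j i ∘ sym)))) ⟩
  1ℚ * f j + 0ℚ                                          ≡⟨ trans (ℚ.+-identityʳ (1ℚ * f j)) (ℚ.*-identityˡ (f j)) ⟩
  f j                                                    ∎

sum-++ : (f : Fin (K +ℕ N) → ℚ) → sum f ≡ sum (λ i → f (i ↑ˡ N)) + sum (λ j → f (K ↑ʳ j))
sum-++ {zero}  f = sym (ℚ.+-identityˡ (sum f))
sum-++ {suc K} {N} f = trans (cong (f zero +_) (sum-++ {K} {N} (f ∘ suc))) (sym (ℚ.+-assoc (f zero) _ _))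

sum-combination : (f g : Fin N → ℚ) (α : ℚ) → ∑[ i < N ] (f i + α * g i) ≡ sum f + α * sum g
sum-combination f g α = begin
  ∑[ i < _ ] (f i + α * g i)        ≡⟨ ∑-distrib-+ f (λ i → α * g i) ⟩
  sum f + ∑[ i < _ ] (α * g i)      ≡⟨ cong (sum f +_) (sym (*-distribˡ-sum α g)) ⟩
  sum f + α * sum g                 ∎

sum-factorʳ : (f g : Fin N → ℚ) (x : ℚ) → ∑[ i < N ] (f i * (g i * x)) ≡ ∑[ i < N ] (f i * g i) * x
sum-factorʳ f g x = trans (sum-cong-≗ (λ i → sym (ℚ.*-assoc (f i) (g i) x))) (sym (*-distribʳ-sum x (λ i → f i * g i)))

combination-of-combinations : (d : Fin K → ℚ) (A : Fin K → Fin N → ℚ) (w : Fin N → ℚ) →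
  ∑[ g < K ] (d g * ∑[ i < N ] (A g i * w i)) ≡ ∑[ i < N ] (∑[ g < K ] (d g * A g i) * w i)
combination-of-combinations {K} {N} d A w = begin
  ∑[ g < K ] (d g * ∑[ i < N ] (A g i * w i))       ≡⟨ sum-cong-≗ (λ g → *-distribˡ-sum (d g) (λ i → A g i * w i)) ⟩
  ∑[ g < K ] ∑[ i < N ] (d g * (A g i * w i))       ≡⟨ ∑-comm (λ g i → d g * (A g i * w i)) ⟩
  ∑[ i < N ] ∑[ g < K ] (d g * (A g i * w i))       ≡⟨ sum-cong-≗ (λ i → sum-factorʳ d (λ g → A g i) (w i)) ⟩
  ∑[ i < N ] (∑[ g < K ] (d g * A g i) * w i)       ∎

IsRelation : {N : ℕ} {E : Set} → (Fin N → E → ℚ) → (Fin N → ℚ) → Set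
IsRelation {N} v c = ∀ e → ∑[ i < N ] (c i * v i e) ≡ 0ℚ

LinearlyIndependent : {N : ℕ} {E : Set} → (Fin N → E → ℚ) → Set
LinearlyIndependent v = ∀ c → IsRelation v c → ∀ i → c i ≡ 0ℚ

NontrivialRelation : {N : ℕ} {E : Set} → (Fin N → E → ℚ) → Set
NontrivialRelation {N} v = Σ (Fin N → ℚ) λ c → IsRelation v c × ∃ λ i → c i ≢ 0ℚ

InSpan : {N : ℕ} {E : Set} → (Fin N → E → ℚ) → (E → ℚ) → Set
InSpan {N} W x = Σ (Fin N → ℚ) λ a → ∀ e → x e ≡ ∑[ i < N ] (a i * W i e)

-- One step of Gaussian elimination: the first vector clears coordinate r from the others.
module Elimination {K N : ℕ} (v : Fin (suc N) → Fin (suc K) → ℚ)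
                   (r : Fin (suc K)) (pivot≢0 : v zero r ≢ 0ℚ) where

  private
    pivot⁻¹ : ℚ
    pivot⁻¹ = 1/_ (v zero r) {{≢-nonZero pivot≢0}}

    ratio : Fin N → ℚ
    ratio i = v (suc i) r * pivot⁻¹

    ratio-pivot : ∀ i → ratio i * v zero r ≡ v (suc i) r
    ratio-pivot i = begin
      v (suc i) r * pivot⁻¹ * v zero r     ≡⟨ ℚ.*-assoc (v (suc i) r) pivot⁻¹ (v zero r) ⟩
      v (suc i) r * (pivot⁻¹ * v zero r)   ≡⟨ cong (v (suc i) r *_) (ℚ.*-inverseˡ (v zero r) {{≢-nonZero pivot≢0}}) ⟩
      v (suc i) r * 1ℚ                     ≡⟨ ℚ.*-identityʳ (v (suc i) r) ⟩
      v (suc i) r                          ∎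

  eliminated : Fin N → Fin K → ℚ
  eliminated i e = v (suc i) (punchIn r e) - ratio i * v zero (punchIn r e)

  relation-from-eliminated : NontrivialRelation eliminated → NontrivialRelation v
  relation-from-eliminated (c′ , c′-rel , j , c′j≢0) = c , relation , suc j , c′j≢0
    where
    S : ℚ
    S = ∑[ i < N ] (c′ i * ratio i)

    c : Fin (suc N) → ℚ
    c zero    = - S
    c (suc i) = c′ i

    at-pivot : - S * v zero r + ∑[ i < N ] (c′ i * v (suc i) r) ≡ 0ℚ
    at-pivot = begin
      - S * v zero r + ∑[ i < N ] (c′ i * v (suc i) r)
        ≡⟨ cong (- S * v zero r +_) (sum-cong-≗ (λ i → cong (c′ i *_) (sym (ratio-pivot i)))) ⟩
      - S * v zero r + ∑[ i < N ] (c′ i * (ratio i * v zero r))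
        ≡⟨ cong (- S * v zero r +_) (sum-factorʳ c′ ratio (v zero r)) ⟩
      - S * v zero r + S * v zero r
        ≡⟨ solve 2 (λ s p → :- s :* p :+ s :* p := con 0ℚ) refl S (v zero r) ⟩
      0ℚ ∎
      where open +-*-Solver using (solve; _:=_; _:+_; _:*_; :-_; _:-_; con)

    off-pivot : ∀ e → - S * v zero (punchIn r e) + ∑[ i < N ] (c′ i * v (suc i) (punchIn r e)) ≡ 0ℚ
    off-pivot e = begin
      - S * y + ∑[ i < N ] (c′ i * a i)                                  ≡⟨ cong (- S * y +_) (sum-cong-≗ split) ⟩
      - S * y + ∑[ i < N ] (c′ i * eliminated i e + y * (c′ i * ratio i)) ≡⟨ cong (- S * y +_) (sum-combination (λ i → c′ i * eliminated i e) (λ i → c′ i * ratio i) y) ⟩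
      - S * y + (∑[ i < N ] (c′ i * eliminated i e) + y * S)             ≡⟨ cong (λ z → - S * y + (z + y * S)) (c′-rel e) ⟩
      - S * y + (0ℚ + y * S)                                             ≡⟨ solve 2 (λ s y → :- s :* y :+ (con 0ℚ :+ y :* s) := con 0ℚ) refl S y ⟩
      0ℚ                                                                 ∎
      where
      open +-*-Solver using (solve; _:=_; _:+_; _:*_; :-_; _:-_; con)
      y = v zero (punchIn r e)
      a = λ i → v (suc i) (punchIn r e)
      split : ∀ i → c′ i * a i ≡ c′ i * eliminated i e + y * (c′ i * ratio i)
      split i = solve 4 (λ c a ρ y → c :* a := c :* (a :- ρ :* y) :+ y :* (c :* ρ)) refl (c′ i) (a i) (ratio i) y

    relation : IsRelation v c
    relation e with r Fin.≟ e
    ... | yes refl = at-pivot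
    ... | no r≢e   = subst (λ e → ∑[ i < suc N ] (c i * v i e) ≡ 0ℚ)
                           (punchIn-punchOut r≢e) (off-pivot (punchOut r≢e))

<⇒dependent : K < N → (v : Fin N → Fin K → ℚ) → NontrivialRelation v
<⇒dependent {zero} {suc N} _ v = (λ _ → 1ℚ) , (λ ()) , zero , λ ()
<⇒dependent {suc K} {suc N} (s≤s K<N) v with any? (λ r → ¬? (v zero r ℚ.≟ 0ℚ))
... | yes (r , pivot≢0) = relation-from-eliminated (<⇒dependent K<N (eliminated))
  where open Elimination v r pivot≢0
... | no no-pivot = unit zero , relation , zero , λ ()
  where
  relation : IsRelation v (unit zero)
  relation e = trans (sum-unit zero (λ i → v i e))
                     (decidable-stable (v zero e ℚ.≟ 0ℚ) (λ v₀e≢0 → no-pivot (e , v₀e≢0)))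

span-remove : (W : Fin (suc N) → E → ℚ) (c : Fin (suc N) → ℚ) → IsRelation W c →
              (j : Fin (suc N)) → c j ≢ 0ℚ → {x : E → ℚ} → InSpan W x → InSpan (W ∘ punchIn j) x
span-remove {N} {E} W c c-rel j cj≢0 (a , x≡) = a′ , λ e → begin
  _                                                  ≡⟨ x≡ e ⟩
  ∑[ i < suc N ] (a i * W i e)                     ≡⟨ sum-remove {i = j} (λ i → a i * W i e) ⟩
  a j * W j e + ∑[ i < N ] (a (punchIn j i) * W (punchIn j i) e)
    ≡⟨ solve 3 (λ a w p → a :* w :+ p := p :+ a :* w) refl (a j) (W j e) _ ⟩
  P e + a j * W j e                                  ≡⟨ cong (λ z → P e + a j * z) (W-j e) ⟩
  P e + a j * (- (c⁻¹ * Q e))                        ≡⟨ solve 4 (λ p a c q → p :+ a :* (:- (c :* q)) := p :+ (:- (a :* c)) :* q) refl (P e) (a j) c⁻¹ (Q e) ⟩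
  P e + (- (a j * c⁻¹)) * Q e                        ≡⟨ sym (sum-combination (λ i → a (punchIn j i) * W (punchIn j i) e) (λ i → c (punchIn j i) * W (punchIn j i) e) (- (a j * c⁻¹))) ⟩
  ∑[ i < N ] (a (punchIn j i) * W (punchIn j i) e + (- (a j * c⁻¹)) * (c (punchIn j i) * W (punchIn j i) e))
    ≡⟨ sum-cong-≗ (λ i → solve 4 (λ a k c w → a :* w :+ k :* (c :* w) := (a :+ k :* c) :* w) refl
                                  (a (punchIn j i)) (- (a j * c⁻¹)) (c (punchIn j i)) (W (punchIn j i) e)) ⟩
  ∑[ i < N ] (a′ i * W (punchIn j i) e)              ∎
  where
  open +-*-Solver using (solve; _:=_; _:+_; _:*_; :-_; _:-_; con)
  c⁻¹ : ℚ
  c⁻¹ = 1/_ (c j) {{≢-nonZero cj≢0}}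
  a′ : Fin N → ℚ
  a′ i = a (punchIn j i) + (- (a j * c⁻¹)) * c (punchIn j i)
  P Q : E → ℚ
  P e = ∑[ i < N ] (a (punchIn j i) * W (punchIn j i) e)
  Q e = ∑[ i < N ] (c (punchIn j i) * W (punchIn j i) e)
  W-j : ∀ e → W j e ≡ - (c⁻¹ * Q e)
  W-j e = begin
    W j e                                ≡⟨ solve 3 (λ w i c → w := i :* c :* w :+ (con 1ℚ :- i :* c) :* w) refl (W j e) c⁻¹ (c j) ⟩
    c⁻¹ * c j * W j e + (1ℚ - c⁻¹ * c j) * W j e
      ≡⟨ cong (λ z → c⁻¹ * c j * W j e + (1ℚ - z) * W j e) (ℚ.*-inverseˡ (c j) {{≢-nonZero cj≢0}}) ⟩
    c⁻¹ * c j * W j e + (1ℚ - 1ℚ) * W j e ≡⟨ solve 4 (λ i c w q → i :* c :* w :+ (con 1ℚ :- con 1ℚ) :* w := :- (i :* q) :+ i :* (c :* w :+ q)) refl c⁻¹ (c j) (W j e) (Q e) ⟩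
    - (c⁻¹ * Q e) + c⁻¹ * (c j * W j e + Q e)
      ≡⟨ cong (λ z → - (c⁻¹ * Q e) + c⁻¹ * z) (trans (sym (sum-remove {i = j} (λ i → c i * W i e))) (c-rel e)) ⟩
    - (c⁻¹ * Q e) + c⁻¹ * 0ℚ             ≡⟨ solve 2 (λ i q → :- (i :* q) :+ i :* con 0ℚ := :- (i :* q)) refl c⁻¹ (Q e) ⟩
    - (c⁻¹ * Q e)                        ∎
    where open +-*-Solver using (solve; _:=_; _:+_; _:*_; :-_; _:-_; con)

independent-in-span⇒≤ : (t : Fin K → E → ℚ) → LinearlyIndependent t →
                        (W : Fin N → E → ℚ) → (∀ g → InSpan W (t g)) → K ≤ N
independent-in-span⇒≤ {K} {N = N} t t-ind W span with K ℕ.≤? N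
... | yes K≤N = K≤N
... | no  K≰N = contradiction-from (<⇒dependent (ℕ.≰⇒> K≰N) (λ g → proj₁ (span g)))
  where
  contradiction-from : NontrivialRelation (λ g → proj₁ (span g)) → K ≤ N
  contradiction-from (d , d-rel , j , dj≢0) = contradiction (t-ind d relation j) dj≢0
    where
    relation : IsRelation t d
    relation e = begin
      ∑[ g < K ] (d g * t g e)                                      ≡⟨ sum-cong-≗ (λ g → cong (d g *_) (proj₂ (span g) e)) ⟩
      ∑[ g < K ] (d g * ∑[ i < N ] (proj₁ (span g) i * W i e))      ≡⟨ combination-of-combinations d (λ g → proj₁ (span g)) (λ i → W i e) ⟩
      ∑[ i < N ] (∑[ g < K ] (d g * proj₁ (span g) i) * W i e)      ≡⟨ sum-zero (λ i → *-killˡ (d-rel i)) ⟩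
      0ℚ                                                            ∎

small-spanning-family-independent : N ≤ K → (t : Fin K → E → ℚ) → LinearlyIndependent t →
  (W : Fin N → E → ℚ) → (∀ g → InSpan W (t g)) → LinearlyIndependent W
small-spanning-family-independent {suc N} N<K t t-ind W span c c-rel j with c j ℚ.≟ 0ℚ
... | yes cj≡0 = cj≡0
... | no  cj≢0 = contradiction (independent-in-span⇒≤ t t-ind (W ∘ punchIn j) (λ g → span-remove W c c-rel j cj≢0 (span g)))
                               (ℕ.<⇒≱ N<K)

reindex : {E : Set} {N K : ℕ} {W : Fin N → E → ℚ} → N ≡ K → LinearlyIndependent W →
          Σ (Fin K → Fin N) λ σ → LinearlyIndependent (W ∘ σ)
reindex refl W-ind = id , W-ind

module _ {M K : ℕ} (M≤K : M ≤ K) (t : Fin K → Fin M → ℚ) (t-ind : LinearlyIndependent t) where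

  Basis : {N : ℕ} → (Fin N → Fin M → ℚ) → Set
  Basis {N} W = Σ (Fin K → Fin N) λ σ → LinearlyIndependent (W ∘ σ)

  mutual
    basis-from-span : {N : ℕ} (W : Fin N → Fin M → ℚ) → (∀ g → InSpan W (t g)) → Basis W
    basis-from-span {N} W span with M ℕ.<? N
    ... | yes M<N = shrink M<N W span
    ... | no  M≮N = reindex (ℕ.≤-antisym N≤K (independent-in-span⇒≤ t t-ind W span))
                            (small-spanning-family-independent N≤K t t-ind W span)
      where
      N≤K : N ≤ K
      N≤K = ℕ.≤-trans (ℕ.≮⇒≥ M≮N) M≤K

    shrink : {N : ℕ} → M < N → (W : Fin N → Fin M → ℚ) → (∀ g → InSpan W (t g)) → Basis W
    shrink {suc N} M<N W span = drop (<⇒dependent M<N W)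
      where
      drop : NontrivialRelation W → Basis W
      drop (c , c-rel , j , cj≢0) =
        map (punchIn j ∘_) id (basis-from-span (W ∘ punchIn j) (λ g → span-remove W c c-rel j cj≢0 (span g)))

span-subfamily : (W : Fin N → E → ℚ) (ι : Fin K → Fin N) {V : Fin K → E → ℚ} →
                 (∀ s e → V s e ≡ W (ι s) e) → {x : E → ℚ} → InSpan V x → InSpan W x
span-subfamily {N} {K = K} W ι {V} V≡W∘ι (α , x≡) = a , λ e → begin
  _                                                      ≡⟨ x≡ e ⟩
  ∑[ s < K ] (α s * V s e)                               ≡⟨ sum-cong-≗ (λ s → cong (α s *_) (trans (V≡W∘ι s e) (sym (sum-unit (ι s) (λ i → W i e))))) ⟩
  ∑[ s < K ] (α s * ∑[ i < N ] (unit (ι s) i * W i e))   ≡⟨ combination-of-combinations α (λ s → unit (ι s)) (λ i → W i e) ⟩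
  ∑[ i < N ] (a i * W i e)                               ∎
  where
  a : Fin N → ℚ
  a i = ∑[ s < K ] (α s * unit (ι s) i)

basis-from-blocks : {X : Set} (vec : X → Fin M → ℚ) → M ≤ K → (t : Fin K → Fin M → ℚ) → LinearlyIndependent t →
  (∀ g → Σ (Fin L → X) λ B → InSpan (vec ∘ B) (t g)) → Σ (Fin K → X) λ w → LinearlyIndependent (vec ∘ w)
basis-from-blocks {K = K} {L} {X} vec M≤K t t-ind blocks =
  map (flat ∘_) id (basis-from-span M≤K t t-ind (vec ∘ flat) span)
  where
  flat : Fin (K *ℕ L) → X
  flat i = proj₁ (blocks (proj₁ (remQuot {K} L i))) (proj₂ (remQuot {K} L i))
  span : ∀ g → InSpan (vec ∘ flat) (t g)
  span g = span-subfamily (vec ∘ flat) (combine g)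
             (λ s e → cong (λ p → vec (proj₁ (blocks (proj₁ p)) (proj₂ p)) e) (sym (remQuot-combine g s)))
             (proj₂ (blocks g))

-- Affine dimension of a face

AffinelyIndependent : {N : ℕ} {E : Set} → (Fin N → E → ℚ) → Set
AffinelyIndependent v = ∀ c → sum c ≡ 0ℚ → IsRelation v c → ∀ i → c i ≡ 0ℚ

fromAffInd : (v : Fin N → E → ℚ) → AffInd v → AffinelyIndependent v
fromAffInd {N} v ind c Σc≡0 c-rel =
  ind c (trans (sumℚ≡sum N c) Σc≡0) (λ e → trans (sumℚ≡sum N _) (c-rel e))

toAffInd : (v : Fin N → E → ℚ) → AffinelyIndependent v → AffInd v
toAffInd {N} v ind c Σc≡0 c-rel =
  ind c (trans (sym (sumℚ≡sum N c)) Σc≡0) (λ e → trans (sym (sumℚ≡sum N _)) (c-rel e))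

module Facet {E : Set} (P : (E → ℚ) → Set) (e : E) {d : ℕ}
             (coord : Fin (suc d) → E) (index : E → Fin (suc d))
             (P-coord : ∀ {x} → P x → ∀ f → x f ≡ x (coord (index f))) where

  Face : (E → ℚ) → Set
  Face x = P x × x e ≡ 1ℚ

  private
    relation-from-coordinates : {v : Fin N → E → ℚ} → (∀ i → P (v i)) → (c : Fin N → ℚ) →
      (∀ g → ∑[ i < N ] (c i * v i (coord g)) ≡ 0ℚ) → IsRelation v c
    relation-from-coordinates v∈P c c-rel f =
      trans (sum-cong-≗ (λ i → cong (c i *_) (P-coord (v∈P i) f))) (c-rel (index f))

    sum≡sum-at-e : {v : Fin N → E → ℚ} → (∀ i → Face (v i)) → (c : Fin N → ℚ) →
                   sum c ≡ ∑[ i < N ] (c i * v i e)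
    sum≡sum-at-e v∈F c = sum-cong-≗ (λ i → trans (sym (ℚ.*-identityʳ (c i))) (cong (c i *_) (sym (proj₂ (v∈F i)))))

  polytope-bound : (v : Fin (3 +ℕ d) → E → ℚ) → (∀ i → P (v i)) → ¬ AffInd v
  polytope-bound v v∈P v-ind = absurd (<⇒dependent ℕ.≤-refl w)
    where
    w : Fin (3 +ℕ d) → Fin (2 +ℕ d) → ℚ
    w i zero    = 1ℚ
    w i (suc g) = v i (coord g)
    absurd : NontrivialRelation w → ⊥
    absurd (c , c-rel , j , cj≢0) = cj≢0 (fromAffInd v v-ind c Σc≡0 (relation-from-coordinates v∈P c (c-rel ∘ suc)) j)
      where
      Σc≡0 : sum c ≡ 0ℚ
      Σc≡0 = trans (sum-cong-≗ (λ i → sym (ℚ.*-identityʳ (c i)))) (c-rel zero)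

  face-bound : (v : Fin (2 +ℕ d) → E → ℚ) → (∀ i → Face (v i)) → ¬ AffInd v
  face-bound v v∈F v-ind = absurd (<⇒dependent ℕ.≤-refl (λ i g → v i (coord g)))
    where
    absurd : NontrivialRelation (λ i g → v i (coord g)) → ⊥
    absurd (c , c-rel , j , cj≢0) = cj≢0 (fromAffInd v v-ind c Σc≡0 relation j)
      where
      relation : IsRelation v c
      relation = relation-from-coordinates (proj₁ ∘ v∈F) c c-rel
      Σc≡0 : sum c ≡ 0ℚ
      Σc≡0 = trans (sum≡sum-at-e v∈F c) (relation e)

  extend-off-face : {B : Fin N → E → ℚ} → (∀ i → Face (B i)) → LinearlyIndependent B →
    {x₀ : E → ℚ} → x₀ e ≡ 0ℚ → AffinelyIndependent (x₀ ∷ B)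
  extend-off-face {N} {B} B∈F B-ind {x₀} x₀e≡0 c Σc≡0 c-rel = coefficients
    where
    Σtail≡0 : ∑[ i < N ] c (suc i) ≡ 0ℚ
    Σtail≡0 = begin
      ∑[ i < N ] c (suc i)                        ≡⟨ sum≡sum-at-e B∈F (c ∘ suc) ⟩
      ∑[ i < N ] (c (suc i) * B i e)              ≡⟨ solve 2 (λ c t → t := c :* con 0ℚ :+ t) refl (c zero) _ ⟩
      c zero * 0ℚ + ∑[ i < N ] (c (suc i) * B i e) ≡⟨ cong (λ z → c zero * z + _) (sym x₀e≡0) ⟩
      c zero * x₀ e + ∑[ i < N ] (c (suc i) * B i e) ≡⟨ c-rel e ⟩
      0ℚ                                           ∎
      where open +-*-Solver using (solve; _:=_; _:+_; _:*_; :-_; _:-_; con)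
    c₀≡0 : c zero ≡ 0ℚ
    c₀≡0 = trans (sym (ℚ.+-identityʳ (c zero))) (trans (cong (c zero +_) (sym Σtail≡0)) Σc≡0)
    tail-relation : IsRelation B (c ∘ suc)
    tail-relation f = trans (sym (+-killˡ (*-killˡ {b = x₀ f} c₀≡0))) (c-rel f)
    coefficients : ∀ i → c i ≡ 0ℚ
    coefficients zero    = c₀≡0
    coefficients (suc i) = B-ind (c ∘ suc) tail-relation i

  facet-dimensions : ∀ {K} → K ≡ suc d → (B : Fin K → E → ℚ) → (∀ i → Face (B i)) → LinearlyIndependent B →
    (x₀ : E → ℚ) → P x₀ → x₀ e ≡ 0ℚ → AffDim P (suc d) × AffDim Face d
  facet-dimensions refl B B∈F B-ind x₀ x₀∈P x₀e≡0 =
    ((x₀ ∷ B , x₀∷B∈P , toAffInd (x₀ ∷ B) (extend-off-face B∈F B-ind x₀e≡0)) , polytope-bound) ,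
    ((B , B∈F , toAffInd B (λ c _ → B-ind c)) , face-bound)
    where
    x₀∷B∈P : ∀ i → P ((x₀ ∷ B) i)
    x₀∷B∈P zero    = x₀∈P
    x₀∷B∈P (suc i) = proj₁ (B∈F i)

-- Unitriangular systems and unit vectors

LowerUnitriangular : {K : ℕ} → (Fin K → Fin K → ℚ) → Set
LowerUnitriangular {zero}  A = ⊤
LowerUnitriangular {suc K} A =
  A zero zero ≡ 1ℚ × (∀ i → A zero (suc i) ≡ 0ℚ) × LowerUnitriangular (λ c i → A (suc c) (suc i))

lower-unitriangular-nonsingular : (A : Fin K → Fin K → ℚ) → LowerUnitriangular A →
  (d : Fin K → ℚ) → (∀ c → ∑[ i < K ] (d i * A c i) ≡ 0ℚ) → ∀ i → d i ≡ 0ℚ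
lower-unitriangular-nonsingular {suc K} A (A₀₀≡1 , A₀ᵢ≡0 , A′-triangular) d rows = d≡0
  where
  d₀≡0 : d zero ≡ 0ℚ
  d₀≡0 = begin
    d zero                                                ≡⟨ solve 1 (λ x → x := x :* con 1ℚ :+ con 0ℚ) refl (d zero) ⟩
    d zero * 1ℚ + 0ℚ                                      ≡⟨ cong₂ (λ a b → d zero * a + b) (sym A₀₀≡1)
                                                               (sym (sum-zero (λ i → *-killʳ {d (suc i)} (A₀ᵢ≡0 i)))) ⟩
    d zero * A zero zero + ∑[ i < K ] (d (suc i) * A zero (suc i)) ≡⟨ rows zero ⟩
    0ℚ                                                    ∎
    where open +-*-Solver using (solve; _:=_; _:+_; _:*_; :-_; _:-_; con)
  rows′ : ∀ c → ∑[ i < K ] (d (suc i) * A (suc c) (suc i)) ≡ 0ℚ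
  rows′ c = trans (sym (+-killˡ (*-killˡ d₀≡0))) (rows (suc c))
  d≡0 : ∀ i → d i ≡ 0ℚ
  d≡0 zero    = d₀≡0
  d≡0 (suc i) = lower-unitriangular-nonsingular (λ c i → A (suc c) (suc i)) A′-triangular (d ∘ suc) rows′ i

Increasing : {K M : ℕ} → (Fin (suc K) → Fin M) → Set
Increasing {K} G = ∀ (i : Fin K) → G (inject₁ i) Fin.< G (suc i)

increasing-injective : (G : Fin (suc K) → Fin M) → Increasing G → Injective _≡_ _≡_ G
increasing-injective {K} G increasing {zero}  {zero}  _  = refl
increasing-injective {K} G increasing {zero}  {suc j} eq = contradiction (cong toℕ eq) (ℕ.<⇒≢ (first-smallest G increasing j))
  where
  first-smallest : ∀ {K} (G : Fin (suc K) → Fin M) → Increasing G → ∀ j → G zero Fin.< G (suc j)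
  first-smallest G increasing zero    = increasing zero
  first-smallest G increasing (suc j) = ℕ.<-trans (increasing zero) (first-smallest (G ∘ suc) (increasing ∘ suc) j)
increasing-injective {K} G increasing {suc i} {zero}  eq = sym (increasing-injective G increasing (sym eq))
increasing-injective {suc K} G increasing {suc i} {suc j} eq = cong suc (increasing-injective (G ∘ suc) (increasing ∘ suc) eq)

complement : (G : Fin K → Fin M) → Injective _≡_ _≡_ G →
             Σ (Fin (M ∸ K) → Fin M) λ κ → Injective _≡_ _≡_ κ × (∀ j i → κ j ≢ G i)
complement {zero}  G _ = id , id , λ _ ()
complement {suc K} {zero}  G _ with G zero
... | ()
complement {suc K} {suc M} G G-inj = extend (complement G′ G′-inj)
  where
  G₀≢ : ∀ i → G zero ≢ G (suc i)
  G₀≢ i eq with G-inj eq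
  ... | ()
  G′ : Fin K → Fin M
  G′ i = punchOut (G₀≢ i)
  G′-inj : Injective _≡_ _≡_ G′
  G′-inj {i} {j} eq with G-inj (punchOut-injective (G₀≢ i) (G₀≢ j) eq)
  ... | refl = refl
  extend : Σ (Fin (M ∸ K) → Fin M) (λ κ → Injective _≡_ _≡_ κ × (∀ j i → κ j ≢ G′ i)) →
           Σ (Fin (M ∸ K) → Fin (suc M)) (λ κ → Injective _≡_ _≡_ κ × (∀ j i → κ j ≢ G i))
  extend (κ , κ-inj , κ≢G′) = punchIn (G zero) ∘ κ , κ-inj ∘ punchIn-injective (G zero) _ _ , avoid
    where
    avoid : ∀ j i → punchIn (G zero) (κ j) ≢ G i
    avoid j zero    = punchInᵢ≢i (G zero) (κ j)
    avoid j (suc i) eq = κ≢G′ j i (punchIn-injective (G zero) _ _ (trans eq (sym (punchIn-punchOut (G₀≢ i)))))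

module _ {K R M : ℕ} (G : Fin K → Fin M) (κ : Fin R → Fin M)
         (κ-inj : Injective _≡_ _≡_ κ) (κ≢G : ∀ j i → κ j ≢ G i) (z : Fin K → Fin M → ℚ)
         (z-nonsingular : ∀ (d : Fin K → ℚ) → (∀ c → ∑[ i < K ] (d i * z i (G c)) ≡ 0ℚ) → ∀ i → d i ≡ 0ℚ) where

  independent-with-units : LinearlyIndependent (z ++ (unit ∘ κ))
  independent-with-units c c-rel x = subst (λ x → c x ≡ 0ℚ) (join-splitAt K R x) (by-part (splitAt K x))
    where
    t = z ++ (unit ∘ κ)
    split : ∀ e → ∑[ i < K ] (c (i ↑ˡ R) * z i e) + ∑[ j < R ] (c (K ↑ʳ j) * unit (κ j) e) ≡ 0ℚ
    split e = begin
      ∑[ i < K ] (c (i ↑ˡ R) * z i e) + ∑[ j < R ] (c (K ↑ʳ j) * unit (κ j) e)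
        ≡⟨ sym (cong₂ _+_ (sum-cong-≗ (λ i → cong (λ v → c (i ↑ˡ R) * v e) (lookup-++ˡ z (unit ∘ κ) i)))
                          (sum-cong-≗ (λ j → cong (λ v → c (K ↑ʳ j) * v e) (lookup-++ʳ z (unit ∘ κ) j)))) ⟩
      ∑[ i < K ] (c (i ↑ˡ R) * t (i ↑ˡ R) e) + ∑[ j < R ] (c (K ↑ʳ j) * t (K ↑ʳ j) e)
        ≡⟨ sym (sum-++ {K} {R} (λ x → c x * t x e)) ⟩
      ∑[ x < K +ℕ R ] (c x * t x e)
        ≡⟨ c-rel e ⟩
      0ℚ ∎
    unit-part-at-G : ∀ i → ∑[ j < R ] (c (K ↑ʳ j) * unit (κ j) (G i)) ≡ 0ℚ
    unit-part-at-G i = sum-zero (λ j → *-killʳ {c (K ↑ʳ j)} (unit-off-diagonal (κ≢G j i)))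
    first : ∀ i → c (i ↑ˡ R) ≡ 0ℚ
    first = z-nonsingular (λ i → c (i ↑ˡ R)) λ i → trans (sym (+-killʳ (unit-part-at-G i))) (split (G i))
    second : ∀ j → c (K ↑ʳ j) ≡ 0ℚ
    second j₀ = begin
      c (K ↑ʳ j₀)                                                   ≡⟨ sym (sum-unit j₀ (λ j → c (K ↑ʳ j))) ⟩
      ∑[ j < R ] (unit j₀ j * c (K ↑ʳ j))                           ≡⟨ sum-cong-≗ (λ j → trans (ℚ.*-comm (unit j₀ j) (c (K ↑ʳ j))) (cong (c (K ↑ʳ j) *_) (unit-at-κ j))) ⟩
      ∑[ j < R ] (c (K ↑ʳ j) * unit (κ j) (κ j₀))                   ≡⟨ sym (+-killˡ (sum-zero (λ i → *-killˡ {b = z i (κ j₀)} (first i)))) ⟩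
      ∑[ i < K ] (c (i ↑ˡ R) * z i (κ j₀)) + ∑[ j < R ] (c (K ↑ʳ j) * unit (κ j) (κ j₀)) ≡⟨ split (κ j₀) ⟩
      0ℚ                                                            ∎
      where
      unit-at-κ : ∀ j → unit j₀ j ≡ unit (κ j) (κ j₀)
      unit-at-κ j with j Fin.≟ j₀
      ... | yes refl = trans (unit-diagonal j) (sym (unit-diagonal (κ j)))
      ... | no  j≢j₀ = trans (unit-off-diagonal (j≢j₀ ∘ sym)) (sym (unit-off-diagonal (j≢j₀ ∘ κ-inj)))
    by-part : ∀ p → c (join K R p) ≡ 0ℚ
    by-part (inj₁ i) = first i
    by-part (inj₂ j) = second j

module Wagner (k₀ : ℕ) where

  h : ℕ
  h = 3 +ℕ k₀

  n : ℕ
  n = h +ℕ h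

  n/2≡h : n / 2 ≡ h
  n/2≡h = trans (cong (_/ 2) (trans (cong (h +ℕ_) (sym (ℕ.+-identityʳ h))) (ℕ.*-comm 2 h))) (m*n/n≡m h 2)

  h<n : h < n
  h<n = ℕ.m<m+n h (s≤s z≤n)

  n∸1<n : n ∸ 1 < n
  n∸1<n = ℕ.n<1+n (n ∸ 1)

  n∸1≡h∸1+h : n ∸ 1 ≡ (h ∸ 1) +ℕ h
  n∸1≡h∸1+h = ℕ.+-∸-comm {h} h {1} (s≤s z≤n)

  vertex : (i : ℕ) → i < n → Fin n
  vertex i i<n = fromℕ< i<n

  toℕ-vertex : ∀ {i} (i<n : i < n) → toℕ (vertex i i<n) ≡ i
  toℕ-vertex i<n = toℕ-fromℕ< i<n

  adj-suc : {u w : Fin n} → toℕ w ≡ suc (toℕ u) → Adj n u w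
  adj-suc w≡1+u = inj₁ (inj₁ w≡1+u)

  adj-wrap : {u w : Fin n} → toℕ u ≡ n ∸ 1 → toℕ w ≡ 0 → Adj n u w
  adj-wrap u≡n-1 w≡0 = inj₁ (inj₂ (inj₁ (u≡n-1 , w≡0)))

  adj-chord : {u w : Fin n} → toℕ w ≡ toℕ u +ℕ h → Adj n u w
  adj-chord {u} w≡u+h = inj₁ (inj₂ (inj₂ (trans w≡u+h (cong (toℕ u +ℕ_) (sym n/2≡h)))))

  Adj-sym : {u w : Fin n} → Adj n u w → Adj n w u
  Adj-sym (inj₁ a) = inj₂ a
  Adj-sym (inj₂ a) = inj₁ a

  module _ {S : Subset n} where

    reach-trans : ∀ {u w v} → Reach S u w → Reach S w v → Reach S u v
    reach-trans here         r′ = r′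
    reach-trans (step a s r) r′ = step a s (reach-trans r r′)

    reach-sym : ∀ {u v} → T (S u) → Reach S u v → Reach S v u
    reach-sym u∈S here            = here
    reach-sym u∈S (step a w∈S r) = reach-trans (reach-sym w∈S r) (step (Adj-sym a) u∈S here)

    connected-via : (root : Fin n) → T (S root) → (∀ u → T (S u) → Reach S u root) → Connected S
    connected-via root root∈S to-root =
      (root , root∈S) , λ u v u∈S v∈S → reach-trans (to-root u u∈S) (reach-sym v∈S (to-root v v∈S))

    private
      reach-down : ∀ d (u v : Fin n) → toℕ u ≡ toℕ v +ℕ d →
                   (∀ z → toℕ v ≤ toℕ z → toℕ z ≤ toℕ u → T (S z)) → Reach S u v
      reach-down zero    u v u≡v _ = subst (Reach S u) (toℕ-injective (trans u≡v (ℕ.+-identityʳ (toℕ v)))) here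
      reach-down (suc d) u v u≡v+1+d between =
        step (Adj-sym (adj-suc u≡1+w)) (between w v≤w w≤u) (reach-down d w v w≡v+d (λ z v≤z z≤w → between z v≤z (ℕ.≤-trans z≤w w≤u)))
        where
        w<n : toℕ v +ℕ d < n
        w<n = ℕ.<-≤-trans (ℕ.≤-reflexive (sym (trans u≡v+1+d (ℕ.+-suc (toℕ v) d)))) (ℕ.<⇒≤ (toℕ<n u))
        w : Fin n
        w = vertex (toℕ v +ℕ d) w<n
        w≡v+d : toℕ w ≡ toℕ v +ℕ d
        w≡v+d = toℕ-vertex w<n
        u≡1+w : toℕ u ≡ suc (toℕ w)
        u≡1+w = trans u≡v+1+d (trans (ℕ.+-suc (toℕ v) d) (cong suc (sym w≡v+d)))
        v≤w : toℕ v ≤ toℕ w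
        v≤w = ℕ.≤-trans (ℕ.m≤m+n (toℕ v) d) (ℕ.≤-reflexive (sym w≡v+d))
        w≤u : toℕ w ≤ toℕ u
        w≤u = ℕ.≤-trans (ℕ.n≤1+n (toℕ w)) (ℕ.≤-reflexive (sym u≡1+w))

    reach-within : ∀ a b → (∀ z → a ≤ toℕ z → toℕ z < b → T (S z)) →
                   ∀ u v → a ≤ toℕ u → toℕ u < b → a ≤ toℕ v → toℕ v < b → Reach S u v
    reach-within a b inside u v a≤u u<b a≤v v<b with ℕ.≤-total (toℕ v) (toℕ u)
    ... | inj₁ v≤u = reach-down (toℕ u ∸ toℕ v) u v (sym (ℕ.m+[n∸m]≡n v≤u))
                       (λ z v≤z z≤u → inside z (ℕ.≤-trans a≤v v≤z) (ℕ.≤-<-trans z≤u u<b))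
    ... | inj₂ u≤v = reach-sym (inside v a≤v v<b) (reach-down (toℕ v ∸ toℕ u) v u (sym (ℕ.m+[n∸m]≡n u≤v))
                       (λ z u≤z z≤v → inside z (ℕ.≤-trans a≤u u≤z) (ℕ.≤-<-trans z≤v v<b)))

  -- Bonds whose shores are unions of arcs

  T⇒≡true : ∀ {b} → T b → b ≡ true
  T⇒≡true = Equivalence.to T-≡

  ¬T⇒≡false : ∀ {b} → ¬ T b → b ≡ false
  ¬T⇒≡false {false} _  = refl
  ¬T⇒≡false {true}  ¬t = contradiction tt ¬t

  <ᵇ-true : ∀ {x y} → x < y → (x <ᵇ y) ≡ true
  <ᵇ-true x<y = T⇒≡true (ℕ.<⇒<ᵇ x<y)

  <ᵇ-false : ∀ {x y} → y ≤ x → (x <ᵇ y) ≡ false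
  <ᵇ-false {x} {y} y≤x = ¬T⇒≡false (λ t → ℕ.<⇒≱ (ℕ.<ᵇ⇒< x y t) y≤x)

  ≤ᵇ-true : ∀ {x y} → x ≤ y → (x ≤ᵇ y) ≡ true
  ≤ᵇ-true x≤y = T⇒≡true (ℕ.≤⇒≤ᵇ x≤y)

  ≤ᵇ-false : ∀ {x y} → y < x → (x ≤ᵇ y) ≡ false
  ≤ᵇ-false {x} {y} y<x = ¬T⇒≡false (λ t → ℕ.<⇒≱ y<x (ℕ.≤ᵇ⇒≤ x y t))

  arcs : ℕ → ℕ → ℕ → ℕ → ℕ → Bool
  arcs p q r s x = (x <ᵇ p) ∨ ((q ≤ᵇ x) ∧ (x <ᵇ r)) ∨ (s ≤ᵇ x)

  Arcs : ℕ → ℕ → ℕ → ℕ → Subset n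
  Arcs p q r s u = arcs p q r s (toℕ u)

  module ArcsMembership (p q r s : ℕ) {x : ℕ} where

    arcs-left : x < p → arcs p q r s x ≡ true
    arcs-left x<p rewrite <ᵇ-true x<p = refl

    arcs-middle : q ≤ x → x < r → arcs p q r s x ≡ true
    arcs-middle q≤x x<r rewrite ≤ᵇ-true q≤x | <ᵇ-true x<r = ∨-zeroʳ (x <ᵇ p)

    arcs-right : s ≤ x → arcs p q r s x ≡ true
    arcs-right s≤x rewrite ≤ᵇ-true s≤x | ∨-zeroʳ ((q ≤ᵇ x) ∧ (x <ᵇ r)) = ∨-zeroʳ (x <ᵇ p)

    arcs-first-gap : q ≤ r → r ≤ s → p ≤ x → x < q → arcs p q r s x ≡ false
    arcs-first-gap q≤r r≤s p≤x x<q
      rewrite <ᵇ-false p≤x | ≤ᵇ-false x<q | ≤ᵇ-false (ℕ.<-≤-trans x<q (ℕ.≤-trans q≤r r≤s)) = refl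

    arcs-second-gap : p ≤ q → q ≤ r → r ≤ x → x < s → arcs p q r s x ≡ false
    arcs-second-gap p≤q q≤r r≤x x<s
      rewrite <ᵇ-false (ℕ.≤-trans p≤q (ℕ.≤-trans q≤r r≤x)) | <ᵇ-false r≤x | ≤ᵇ-false x<s
            | ∧-zeroʳ (q ≤ᵇ x) = refl

    arcs-true : arcs p q r s x ≡ true → x < p ⊎ (q ≤ x × x < r) ⊎ s ≤ x
    arcs-true x∈ with Equivalence.to T-∨ (Equivalence.from T-≡ x∈)
    ... | inj₁ x<p = inj₁ (ℕ.<ᵇ⇒< x p x<p)
    ... | inj₂ rest with Equivalence.to T-∨ rest
    ...   | inj₁ middle = inj₂ (inj₁ (ℕ.≤ᵇ⇒≤ q x (proj₁ (Equivalence.to T-∧ middle)) ,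
                                      ℕ.<ᵇ⇒< x r (proj₂ (Equivalence.to T-∧ middle))))
    ...   | inj₂ s≤x   = inj₂ (inj₂ (ℕ.≤ᵇ⇒≤ s x s≤x))

    arcs-false : arcs p q r s x ≡ false → (p ≤ x × x < q) ⊎ (r ≤ x × x < s)
    arcs-false x∉ with ℕ.<-≤-connex x p | ℕ.<-≤-connex x q | ℕ.<-≤-connex x r | ℕ.<-≤-connex x s
    ... | inj₁ x<p | _        | _        | _        = contradiction (trans (sym (arcs-left x<p)) x∉) λ ()
    ... | inj₂ p≤x | inj₁ x<q | _        | _        = inj₁ (p≤x , x<q)
    ... | inj₂ _   | inj₂ q≤x | inj₁ x<r | _        = contradiction (trans (sym (arcs-middle q≤x x<r)) x∉) λ ()
    ... | inj₂ _   | inj₂ _   | inj₂ r≤x | inj₁ x<s = inj₂ (r≤x , x<s)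
    ... | inj₂ _   | inj₂ _   | inj₂ _   | inj₂ s≤x = contradiction (trans (sym (arcs-right s≤x)) x∉) λ ()

  IsBond : Subset n → Set
  IsBond S = Connected S × Connected (Complement S)

  Interval : ℕ → ℕ → ℕ → Set
  Interval a b x = a ≤ x × x < b

  record Joins (A B : ℕ → Set) : Set where
    constructor joins
    field
      {x y}    : Fin n
      adjacent : Adj n x y
      x∈A      : A (toℕ x)
      y∈B      : B (toℕ y)

  joins-at : ∀ {A B : ℕ → Set} {i j} (i<n : i < n) (j<n : j < n) →
             Adj n (vertex i i<n) (vertex j j<n) → A i → B j → Joins A B
  joins-at {A} {B} i<n j<n adj i∈A j∈B =
    joins adj (subst A (sym (toℕ-vertex i<n)) i∈A) (subst B (sym (toℕ-vertex j<n)) j∈B)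

  adj-vertex-suc : ∀ {i} (i<n : i < n) (i+1<n : suc i < n) → Adj n (vertex i i<n) (vertex (suc i) i+1<n)
  adj-vertex-suc i<n i+1<n = adj-suc (trans (toℕ-vertex i+1<n) (cong suc (sym (toℕ-vertex i<n))))

  adj-vertex-chord : ∀ {i} (i<n : i < n) (i+h<n : i +ℕ h < n) → Adj n (vertex i i<n) (vertex (i +ℕ h) i+h<n)
  adj-vertex-chord i<n i+h<n = adj-chord (trans (toℕ-vertex i+h<n) (cong (_+ℕ h) (sym (toℕ-vertex i<n))))

  first-vertex : Fin n
  first-vertex = vertex 0 (s≤s z≤n)

  last-vertex : Fin n
  last-vertex = vertex (n ∸ 1) (ℕ.n<1+n (n ∸ 1))

  toℕ-first : toℕ first-vertex ≡ 0
  toℕ-first = toℕ-vertex (s≤s z≤n)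

  toℕ-last : toℕ last-vertex ≡ n ∸ 1
  toℕ-last = toℕ-vertex (ℕ.n<1+n (n ∸ 1))

  ≤-last : (u : Fin n) → toℕ u ≤ n ∸ 1
  ≤-last u = ℕ.≤-pred (toℕ<n u)

  module _ {p q r s : ℕ} where

    open ArcsMembership p q r s

    private
      ∈Arcs : ∀ u → arcs p q r s (toℕ u) ≡ true → T (Arcs p q r s u)
      ∈Arcs u = Equivalence.from (T-≡ {Arcs p q r s u})

      ∉Arcs : ∀ u → arcs p q r s (toℕ u) ≡ false → T (Complement (Arcs p q r s) u)
      ∉Arcs u = Equivalence.from (T-not-≡ {Arcs p q r s u})

    OutsideMiddle : ℕ → Set
    OutsideMiddle x = x < p ⊎ s ≤ x

    arcs-connected : 1 ≤ p → (q < r → Joins OutsideMiddle (Interval q r)) → Connected (Arcs p q r s)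
    arcs-connected 1≤p link = connected-via first-vertex first∈ to-first
      where
      S = Arcs p q r s
      first∈ : T (S first-vertex)
      first∈ = ∈Arcs first-vertex (arcs-left (subst (_< p) (sym toℕ-first) 1≤p))
      from-left : ∀ u → toℕ u < p → Reach S u first-vertex
      from-left u u<p = reach-within 0 p (λ z _ z<p → ∈Arcs z (arcs-left z<p))
                          u first-vertex z≤n u<p z≤n (subst (_< p) (sym toℕ-first) 1≤p)
      from-right : ∀ u → s ≤ toℕ u → Reach S u first-vertex
      from-right u s≤u =
        reach-trans (reach-within s n (λ z s≤z _ → ∈Arcs z (arcs-right s≤z)) u last-vertex s≤u (toℕ<n u)
                       (ℕ.≤-trans s≤u (subst (toℕ u ≤_) (sym toℕ-last) (≤-last u))) (toℕ<n last-vertex))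
                    (step (adj-wrap toℕ-last toℕ-first) first∈ here)
      from-outside : ∀ u → OutsideMiddle (toℕ u) → Reach S u first-vertex
      from-outside u (inj₁ u<p) = from-left u u<p
      from-outside u (inj₂ s≤u) = from-right u s≤u
      outside∈ : ∀ u → OutsideMiddle (toℕ u) → T (S u)
      outside∈ u (inj₁ u<p) = ∈Arcs u (arcs-left u<p)
      outside∈ u (inj₂ s≤u) = ∈Arcs u (arcs-right s≤u)
      to-first : ∀ u → T (S u) → Reach S u first-vertex
      to-first u u∈S with arcs-true (Equivalence.to (T-≡ {S u}) u∈S)
      ... | inj₁ u<p        = from-left u u<p
      ... | inj₂ (inj₂ s≤u) = from-right u s≤u
      ... | inj₂ (inj₁ (q≤u , u<r)) with link (ℕ.≤-<-trans q≤u u<r)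
      ...   | joins {x} {y} x~y x-out (q≤y , y<r) =
              reach-trans (reach-within q r (λ z q≤z z<r → ∈Arcs z (arcs-middle q≤z z<r)) u y q≤u u<r q≤y y<r)
                          (step (Adj-sym x~y) (outside∈ x x-out) (from-outside x x-out))

    gaps-connected : p ≤ q → q ≤ r → r ≤ s → s ≤ n → p < q ⊎ r < s →
                     (p < q → r < s → Joins (Interval p q) (Interval r s)) →
                     Connected (Complement (Arcs p q r s))
    gaps-connected p≤q q≤r r≤s s≤n nonempty link = root-of nonempty
      where
      C = Complement (Arcs p q r s)
      in-first : ∀ z → p ≤ toℕ z → toℕ z < q → T (C z)
      in-first z p≤z z<q = ∉Arcs z (arcs-first-gap q≤r r≤s p≤z z<q)
      in-second : ∀ z → r ≤ toℕ z → toℕ z < s → T (C z)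
      in-second z r≤z z<s = ∉Arcs z (arcs-second-gap p≤q q≤r r≤z z<s)
      gap-of : ∀ u → T (C u) → Interval p q (toℕ u) ⊎ Interval r s (toℕ u)
      gap-of u u∈C = arcs-false (Equivalence.to (T-not-≡ {Arcs p q r s u}) u∈C)
      root-of : p < q ⊎ r < s → Connected C
      root-of (inj₁ p<q) = connected-via root (in-first root p≤root root<q) to-root
        where
        p<n = ℕ.<-≤-trans p<q (ℕ.≤-trans q≤r (ℕ.≤-trans r≤s s≤n))
        root = vertex p p<n
        p≤root = ℕ.≤-reflexive (sym (toℕ-vertex p<n))
        root<q = subst (_< q) (sym (toℕ-vertex p<n)) p<q
        to-root : ∀ u → T (C u) → Reach C u root
        to-root u u∈C with gap-of u u∈C
        ... | inj₁ (p≤u , u<q) = reach-within p q in-first u root p≤u u<q p≤root root<q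
        ... | inj₂ (r≤u , u<s) with link p<q (ℕ.≤-<-trans r≤u u<s)
        ...   | joins {x} {y} x~y (p≤x , x<q) (r≤y , y<s) =
                reach-trans (reach-within r s in-second u y r≤u u<s r≤y y<s)
                            (step (Adj-sym x~y) (in-first x p≤x x<q) (reach-within p q in-first x root p≤x x<q p≤root root<q))
      root-of (inj₂ r<s) = connected-via root (in-second root r≤root root<s) to-root
        where
        r<n = ℕ.<-≤-trans r<s s≤n
        root = vertex r r<n
        r≤root = ℕ.≤-reflexive (sym (toℕ-vertex r<n))
        root<s = subst (_< s) (sym (toℕ-vertex r<n)) r<s
        to-root : ∀ u → T (C u) → Reach C u root
        to-root u u∈C with gap-of u u∈C
        ... | inj₂ (r≤u , u<s) = reach-within r s in-second u root r≤u u<s r≤root root<s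
        ... | inj₁ (p≤u , u<q) with link (ℕ.≤-<-trans p≤u u<q) r<s
        ...   | joins {x} {y} x~y (p≤x , x<q) (r≤y , y<s) =
                reach-trans (reach-within p q in-first u x p≤u u<q p≤x x<q)
                            (step x~y (in-second y r≤y y<s) (reach-within r s in-second y root r≤y y<s r≤root root<s))

  arcs-bond : ∀ {p q r s} → 1 ≤ p → p ≤ q → q ≤ r → r ≤ s → s ≤ n → p < q ⊎ r < s →
    (q < r → Joins (OutsideMiddle {p} {q} {r} {s}) (Interval q r)) →
    (p < q → r < s → Joins (Interval p q) (Interval r s)) → IsBond (Arcs p q r s)
  arcs-bond 1≤p p≤q q≤r r≤s s≤n nonempty middle-link gap-link =
    arcs-connected 1≤p middle-link , gaps-connected p≤q q≤r r≤s s≤n nonempty gap-link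

  -- the cyclic interval [s, p) through vertex 0
  interval-bond : ∀ {p s} → 1 ≤ p → p < s → s ≤ n → IsBond (Arcs p p p s)
  interval-bond {p} 1≤p p<s s≤n =
    arcs-bond 1≤p ℕ.≤-refl ℕ.≤-refl (ℕ.<⇒≤ p<s) s≤n (inj₂ p<s)
      (λ p<p → contradiction p<p (ℕ.<-irrefl refl)) (λ p<p _ → contradiction p<p (ℕ.<-irrefl refl))

  open import Data.Bool.Solver using (module ∨-∧-Solver)
  open import Data.Rational using (ℚ; 0ℚ; 1ℚ; _+_; _-_; -_)

  ≡ᵇ⇒≡ : ∀ x y → (x ≡ᵇ y) ≡ true → x ≡ y
  ≡ᵇ⇒≡ x y eq = ℕ.≡ᵇ⇒≡ x y (Equivalence.from T-≡ eq)

  ≡ᵇ-refl : ∀ x → (x ≡ᵇ x) ≡ true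
  ≡ᵇ-refl zero    = refl
  ≡ᵇ-refl (suc x) = ≡ᵇ-refl x

  insert : ℕ → (ℕ → Bool) → ℕ → Bool
  insert c f x = f x ∨ (x ≡ᵇ c)

  private
    <ᵇ-suc : ∀ x p → (x <ᵇ suc p) ≡ (x <ᵇ p) ∨ (x ≡ᵇ p)
    <ᵇ-suc zero    zero    = refl
    <ᵇ-suc zero    (suc p) = refl
    <ᵇ-suc (suc x) zero    = refl
    <ᵇ-suc (suc x) (suc p) = <ᵇ-suc x p

    ≡ᵇ-sym : ∀ x y → (x ≡ᵇ y) ≡ (y ≡ᵇ x)
    ≡ᵇ-sym zero    zero    = refl
    ≡ᵇ-sym zero    (suc y) = refl
    ≡ᵇ-sym (suc x) zero    = refl
    ≡ᵇ-sym (suc x) (suc y) = ≡ᵇ-sym x y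

    ≤ᵇ-pred : ∀ x s → (s ≤ᵇ x) ≡ (suc s ≤ᵇ x) ∨ (x ≡ᵇ s)
    ≤ᵇ-pred zero    zero    = refl
    ≤ᵇ-pred (suc x) zero    = refl
    ≤ᵇ-pred zero    (suc s) = refl
    ≤ᵇ-pred (suc x) (suc s) = trans (<ᵇ-suc s x) (cong ((s <ᵇ x) ∨_) (≡ᵇ-sym s x))

    at-end-of-middle : ∀ {q r} x → q ≤ r → (q ≤ᵇ x) ∧ (x ≡ᵇ r) ≡ (x ≡ᵇ r)
    at-end-of-middle {q} {r} x q≤r with x ≡ᵇ r in x=r
    ... | true  = trans (cong (λ y → (q ≤ᵇ y) ∧ true) (≡ᵇ⇒≡ x r x=r)) (cong (_∧ true) (≤ᵇ-true q≤r))
    ... | false = ∧-zeroʳ (q ≤ᵇ x)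

    at-start-of-middle : ∀ {q r} x → q < r → (x ≡ᵇ q) ∧ (x <ᵇ r) ≡ (x ≡ᵇ q)
    at-start-of-middle {q} {r} x q<r with x ≡ᵇ q in x=q
    ... | true  = trans (cong (_<ᵇ r) (≡ᵇ⇒≡ x q x=q)) (<ᵇ-true q<r)
    ... | false = refl

    empty-middle-false : ∀ q x → (q ≤ᵇ x) ∧ (x <ᵇ q) ≡ false
    empty-middle-false q x with x <ᵇ q in x<q
    ... | true  = cong (_∧ true) (≤ᵇ-false (ℕ.<ᵇ⇒< x q (Equivalence.from T-≡ x<q)))
    ... | false = ∧-zeroʳ (q ≤ᵇ x)

  grow-left : ∀ p q r s x → arcs (suc p) q r s x ≡ insert p (arcs p q r s) x
  grow-left p q r s x =
    trans (cong (_∨ ((q ≤ᵇ x) ∧ (x <ᵇ r)) ∨ (s ≤ᵇ x)) (<ᵇ-suc x p))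
          (solve 4 (λ a e m t → (a :+ e) :+ (m :+ t) := (a :+ (m :+ t)) :+ e) refl (x <ᵇ p) (x ≡ᵇ p) ((q ≤ᵇ x) ∧ (x <ᵇ r)) (s ≤ᵇ x))
    where open ∨-∧-Solver using (solve; _:=_; _:+_; _:*_)

  grow-middle-right : ∀ p q r s x → q ≤ r → arcs p q (suc r) s x ≡ insert r (arcs p q r s) x
  grow-middle-right p q r s x q≤r = begin
    arcs p q (suc r) s x
      ≡⟨ cong (λ b → (x <ᵇ p) ∨ ((q ≤ᵇ x) ∧ b) ∨ (s ≤ᵇ x)) (<ᵇ-suc x r) ⟩
    (x <ᵇ p) ∨ ((q ≤ᵇ x) ∧ ((x <ᵇ r) ∨ (x ≡ᵇ r))) ∨ (s ≤ᵇ x)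
      ≡⟨ solve 5 (λ a m e l t → a :+ ((m :* (l :+ e)) :+ t) := (a :+ ((m :* l) :+ t)) :+ (m :* e)) refl
                 (x <ᵇ p) (q ≤ᵇ x) (x ≡ᵇ r) (x <ᵇ r) (s ≤ᵇ x) ⟩
    arcs p q r s x ∨ ((q ≤ᵇ x) ∧ (x ≡ᵇ r))
      ≡⟨ cong (arcs p q r s x ∨_) (at-end-of-middle x q≤r) ⟩
    insert r (arcs p q r s) x ∎
    where
    open ≡-Reasoning
    open ∨-∧-Solver using (solve; _:=_; _:+_; _:*_)

  grow-middle-left : ∀ p q r s x → q < r → arcs p q r s x ≡ insert q (arcs p (suc q) r s) x
  grow-middle-left p q r s x q<r = begin
    arcs p q r s x
      ≡⟨ cong (λ b → (x <ᵇ p) ∨ (b ∧ (x <ᵇ r)) ∨ (s ≤ᵇ x)) (≤ᵇ-pred x q) ⟩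
    (x <ᵇ p) ∨ (((suc q ≤ᵇ x) ∨ (x ≡ᵇ q)) ∧ (x <ᵇ r)) ∨ (s ≤ᵇ x)
      ≡⟨ solve 5 (λ a m e l t → a :+ (((m :+ e) :* l) :+ t) := (a :+ ((m :* l) :+ t)) :+ (e :* l)) refl
                 (x <ᵇ p) (suc q ≤ᵇ x) (x ≡ᵇ q) (x <ᵇ r) (s ≤ᵇ x) ⟩
    arcs p (suc q) r s x ∨ ((x ≡ᵇ q) ∧ (x <ᵇ r))
      ≡⟨ cong (arcs p (suc q) r s x ∨_) (at-start-of-middle x q<r) ⟩
    insert q (arcs p (suc q) r s) x ∎
    where
    open ≡-Reasoning
    open ∨-∧-Solver using (solve; _:=_; _:+_; _:*_)

  grow-right : ∀ p q r s x → arcs p q r s x ≡ insert s (arcs p q r (suc s)) x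
  grow-right p q r s x =
    trans (cong (λ b → (x <ᵇ p) ∨ ((q ≤ᵇ x) ∧ (x <ᵇ r)) ∨ b) (≤ᵇ-pred x s))
          (solve 4 (λ a m t e → a :+ (m :+ (t :+ e)) := (a :+ (m :+ t)) :+ e) refl (x <ᵇ p) ((q ≤ᵇ x) ∧ (x <ᵇ r)) (suc s ≤ᵇ x) (x ≡ᵇ s))
    where open ∨-∧-Solver using (solve; _:=_; _:+_; _:*_)

  empty-middle : ∀ p q q′ s x → arcs p q q s x ≡ arcs p q′ q′ s x
  empty-middle p q q′ s x =
    cong (λ b → (x <ᵇ p) ∨ b ∨ (s ≤ᵇ x)) (trans (empty-middle-false q x) (sym (empty-middle-false q′ x)))

  -- Edge coordinates and the square identity

  toQ : Bool → ℚ
  toQ true  = 1ℚ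
  toQ false = 0ℚ

  cut : (ℕ → Bool) → ℕ → ℕ → ℚ
  cut f x y = toQ (f x xor f y)

  lower upper : Edge n → ℕ
  lower e = toℕ (proj₁ (proj₁ e))
  upper e = toℕ (proj₂ (proj₁ e))

  lower<upper : (e : Edge n) → lower e < upper e
  lower<upper e = proj₁ (proj₂ e)

  cutVec≡toQ : ∀ S (e : Edge n) → cutVec S e ≡ toQ (S (proj₁ (proj₁ e)) xor S (proj₂ (proj₁ e)))
  cutVec≡toQ S ((i , j) , _) with S i xor S j
  ... | true  = refl
  ... | false = refl

  cutVec-positions : ∀ f (e : Edge n) → cutVec (f ∘ toℕ) e ≡ cut f (lower e) (upper e)
  cutVec-positions f = cutVec≡toQ (f ∘ toℕ)

  private
    data Class : Bool → Bool → Bool → Set where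
      inside  : Class true  false false
      outside : Class false false false
      at-a    : Class false true  false
      at-b    : Class false false true

    classify : ∀ {f : ℕ → Bool} {a b} → f a ≡ false → f b ≡ false → a ≢ b → ∀ x → Class (f x) (x ≡ᵇ a) (x ≡ᵇ b)
    classify {f} {a} {b} fa fb a≢b x with x ≡ᵇ a in x=a | x ≡ᵇ b in x=b | f x in fx
    ... | true  | true  | _     = contradiction (trans (sym (≡ᵇ⇒≡ x a x=a)) (≡ᵇ⇒≡ x b x=b)) a≢b
    ... | true  | false | true  = contradiction (trans (sym fx) (trans (cong f (≡ᵇ⇒≡ x a x=a)) fa)) λ ()
    ... | true  | false | false = at-a
    ... | false | true  | true  = contradiction (trans (sym fx) (trans (cong f (≡ᵇ⇒≡ x b x=b)) fb)) λ ()
    ... | false | true  | false = at-b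
    ... | false | false | true  = inside
    ... | false | false | false = outside

    square-classes : ∀ {s α β s′ α′ β′} → Class s α β → Class s′ α′ β′ →
      toQ (s xor s′) - toQ ((s ∨ α) xor (s′ ∨ α′)) - toQ ((s ∨ β) xor (s′ ∨ β′))
        + toQ (((s ∨ α) ∨ β) xor ((s′ ∨ α′) ∨ β′))
      ≡ - (toQ ((α ∧ β′) ∨ (β ∧ α′)) + toQ ((α ∧ β′) ∨ (β ∧ α′)))
    square-classes inside  inside  = refl
    square-classes inside  outside = refl
    square-classes inside  at-a    = refl
    square-classes inside  at-b    = refl
    square-classes outside inside  = refl
    square-classes outside outside = refl
    square-classes outside at-a    = refl
    square-classes outside at-b    = refl
    square-classes at-a    inside  = refl
    square-classes at-a    outside = refl
    square-classes at-a    at-a    = refl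
    square-classes at-a    at-b    = refl
    square-classes at-b    inside  = refl
    square-classes at-b    outside = refl
    square-classes at-b    at-a    = refl
    square-classes at-b    at-b    = refl

  -- Inclusion–exclusion over the four sets S, S + a, S + b, S + a + b cancels every edge but ab.
  square-identity : ∀ {f : ℕ → Bool} {a b} → f a ≡ false → f b ≡ false → a ≢ b → ∀ x y →
    cut f x y - cut (insert a f) x y - cut (insert b f) x y + cut (insert b (insert a f)) x y
    ≡ - (toQ (((x ≡ᵇ a) ∧ (y ≡ᵇ b)) ∨ ((x ≡ᵇ b) ∧ (y ≡ᵇ a))) + toQ (((x ≡ᵇ a) ∧ (y ≡ᵇ b)) ∨ ((x ≡ᵇ b) ∧ (y ≡ᵇ a))))
  square-identity {f} {a} {b} fa fb a≢b x y = square-classes (classify {f} fa fb a≢b x) (classify {f} fa fb a≢b y)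

  m : ℕ
  m = n +ℕ h

  private
    n∸1≡h+[h∸1] : n ∸ 1 ≡ h +ℕ (h ∸ 1)
    n∸1≡h+[h∸1] = ℕ.+-∸-assoc h {h} {1} (s≤s z≤n)

    n∸1≢h : n ∸ 1 ≢ h
    n∸1≢h eq with ℕ.+-cancelˡ-≡ h (h ∸ 1) 0 (trans (sym n∸1≡h+[h∸1]) (trans eq (sym (ℕ.+-identityʳ h))))
    ... | ()

    last-index : (i : Fin n) → ¬ (suc (toℕ i) < n) → toℕ i ≡ n ∸ 1
    last-index i i+1≮n = cong (_∸ 1) (ℕ.≤-antisym (toℕ<n i) (ℕ.≮⇒≥ i+1≮n))

  cycle-edge : Fin n → Edge n
  cycle-edge i with suc (toℕ i) ℕ.<? n
  ... | yes i+1<n = (i , vertex (suc (toℕ i)) i+1<n) , ℕ.≤-reflexive (sym (toℕ-vertex i+1<n)) , adj-suc (toℕ-vertex i+1<n)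
  ... | no  i+1≮n = (first-vertex , i) , subst (_< toℕ i) (sym toℕ-first) 0<i , Adj-sym (adj-wrap (last-index i i+1≮n) toℕ-first)
    where
    0<i : 0 < toℕ i
    0<i = subst (0 <_) (sym (last-index i i+1≮n)) (s≤s z≤n)

  private
    chord-start<n : (j : Fin h) → toℕ j < n
    chord-start<n j = ℕ.<-≤-trans (toℕ<n j) (ℕ.m≤m+n h h)

    chord-end<n : (j : Fin h) → toℕ j +ℕ h < n
    chord-end<n j = ℕ.+-monoˡ-< h (toℕ<n j)

  chord-edge : Fin h → Edge n
  chord-edge j = (start , end) , start<end , adj-chord (trans (toℕ-vertex (chord-end<n j)) (cong (_+ℕ h) (sym (toℕ-vertex (chord-start<n j)))))
    where
    start = vertex (toℕ j) (chord-start<n j)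
    end   = vertex (toℕ j +ℕ h) (chord-end<n j)
    start<end : toℕ start < toℕ end
    start<end = subst₂ _<_ (sym (toℕ-vertex (chord-start<n j))) (sym (toℕ-vertex (chord-end<n j))) (ℕ.m<m+n (toℕ j) (s≤s z≤n))

  coord : Fin m → Edge n
  coord = cycle-edge ++ chord-edge

  SameEnds : Edge n → Edge n → Set
  SameEnds e e′ = lower e ≡ lower e′ × upper e ≡ upper e′

  cycle-coord : (i : Fin n) → suc (toℕ i) < n → lower (coord (i ↑ˡ h)) ≡ toℕ i × upper (coord (i ↑ˡ h)) ≡ suc (toℕ i)
  cycle-coord i i+1<n rewrite lookup-++ˡ cycle-edge chord-edge i with suc (toℕ i) ℕ.<? n
  ... | yes i+1<n′ = refl , toℕ-vertex i+1<n′
  ... | no  i+1≮n  = contradiction i+1<n i+1≮n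

  wrap-coord : (i : Fin n) → toℕ i ≡ n ∸ 1 → lower (coord (i ↑ˡ h)) ≡ 0 × upper (coord (i ↑ˡ h)) ≡ n ∸ 1
  wrap-coord i i≡n∸1 rewrite lookup-++ˡ cycle-edge chord-edge i with suc (toℕ i) ℕ.<? n
  ... | yes i+1<n = contradiction (subst (λ x → suc x < n) i≡n∸1 i+1<n) (ℕ.<-irrefl refl)
  ... | no  _     = toℕ-first , i≡n∸1

  chord-coord : (j : Fin h) → lower (coord (n ↑ʳ j)) ≡ toℕ j × upper (coord (n ↑ʳ j)) ≡ toℕ j +ℕ h
  chord-coord j rewrite lookup-++ʳ cycle-edge chord-edge j = toℕ-vertex (chord-start<n j) , toℕ-vertex (chord-end<n j)

  data CoordView : Fin m → Set where
    cycle : (i : Fin n) → suc (toℕ i) < n → CoordView (i ↑ˡ h)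
    wrap  : (i : Fin n) → toℕ i ≡ n ∸ 1 → CoordView (i ↑ˡ h)
    chord : (j : Fin h) → CoordView (n ↑ʳ j)

  coord-view : (g : Fin m) → CoordView g
  coord-view g = subst CoordView (join-splitAt n h g) (from-split (splitAt n g))
    where
    from-split : (x : Fin n ⊎ Fin h) → CoordView (join n h x)
    from-split (inj₁ i) with suc (toℕ i) ℕ.<? n
    ... | yes i+1<n = cycle i i+1<n
    ... | no  i+1≮n = wrap i (last-index i i+1≮n)
    from-split (inj₂ j) = chord j

  private
    cycle≢wrap : ∀ i → suc (toℕ i) < n → ∀ i′ → toℕ i′ ≡ n ∸ 1 →
      lower (coord (i ↑ˡ h)) ≡ lower (coord (i′ ↑ˡ h)) → upper (coord (i ↑ˡ h)) ≡ upper (coord (i′ ↑ˡ h)) → ⊥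
    cycle≢wrap i p i′ e′ l≡ u≡ = 1≢n∸1 (trans (cong suc (sym i≡0)) (trans (sym (proj₂ (cycle-coord i p))) (trans u≡ (proj₂ (wrap-coord i′ e′)))))
      where
      i≡0 : toℕ i ≡ 0
      i≡0 = trans (sym (proj₁ (cycle-coord i p))) (trans l≡ (proj₁ (wrap-coord i′ e′)))
      1≢n∸1 : 1 ≢ n ∸ 1
      1≢n∸1 ()

    cycle≢chord : ∀ i → suc (toℕ i) < n → ∀ j →
      lower (coord (i ↑ˡ h)) ≡ lower (coord (n ↑ʳ j)) → upper (coord (i ↑ˡ h)) ≡ upper (coord (n ↑ʳ j)) → ⊥
    cycle≢chord i p j l≡ u≡ = 1≢h (ℕ.+-cancelˡ-≡ (toℕ j) 1 h (trans (ℕ.+-comm (toℕ j) 1) j+1≡j+h))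
      where
      1≢h : 1 ≢ h
      1≢h ()
      i≡j : toℕ i ≡ toℕ j
      i≡j = trans (sym (proj₁ (cycle-coord i p))) (trans l≡ (proj₁ (chord-coord j)))
      j+1≡j+h : suc (toℕ j) ≡ toℕ j +ℕ h
      j+1≡j+h = trans (cong suc (sym i≡j)) (trans (sym (proj₂ (cycle-coord i p))) (trans u≡ (proj₂ (chord-coord j))))

    wrap≢chord : ∀ i → toℕ i ≡ n ∸ 1 → ∀ j →
      lower (coord (i ↑ˡ h)) ≡ lower (coord (n ↑ʳ j)) → upper (coord (i ↑ˡ h)) ≡ upper (coord (n ↑ʳ j)) → ⊥
    wrap≢chord i e j l≡ u≡ = n∸1≢h (trans (sym (proj₂ (wrap-coord i e))) (trans u≡ (trans (proj₂ (chord-coord j)) (cong (_+ℕ h) j≡0))))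
      where
      j≡0 : toℕ j ≡ 0
      j≡0 = trans (sym (proj₁ (chord-coord j))) (trans (sym l≡) (proj₁ (wrap-coord i e)))

  coord-injective : ∀ g g′ → SameEnds (coord g) (coord g′) → g ≡ g′
  coord-injective g g′ (lower≡ , upper≡) = by-views (coord-view g) (coord-view g′) lower≡ upper≡
    where
    by-views : ∀ {g g′} → CoordView g → CoordView g′ →
               lower (coord g) ≡ lower (coord g′) → upper (coord g) ≡ upper (coord g′) → g ≡ g′
    by-views (cycle i p) (cycle i′ p′) l≡ _ =
      cong (_↑ˡ h) (toℕ-injective (trans (sym (proj₁ (cycle-coord i p))) (trans l≡ (proj₁ (cycle-coord i′ p′)))))
    by-views (wrap i e) (wrap i′ e′) _ _ = cong (_↑ˡ h) (toℕ-injective (trans e (sym e′)))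
    by-views (chord j) (chord j′) l≡ _ =
      cong (n ↑ʳ_) (toℕ-injective (trans (sym (proj₁ (chord-coord j))) (trans l≡ (proj₁ (chord-coord j′)))))
    by-views (cycle i p) (wrap i′ e′) l≡ u≡ = ⊥-elim (cycle≢wrap i p i′ e′ l≡ u≡)
    by-views (wrap i e) (cycle i′ p′) l≡ u≡ = ⊥-elim (cycle≢wrap i′ p′ i e (sym l≡) (sym u≡))
    by-views (cycle i p) (chord j) l≡ u≡ = ⊥-elim (cycle≢chord i p j l≡ u≡)
    by-views (chord j) (cycle i p) l≡ u≡ = ⊥-elim (cycle≢chord i p j (sym l≡) (sym u≡))
    by-views (wrap i e) (chord j) l≡ u≡ = ⊥-elim (wrap≢chord i e j l≡ u≡)
    by-views (chord j) (wrap i e) l≡ u≡ = ⊥-elim (wrap≢chord i e j (sym l≡) (sym u≡))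

  coord-surjective : (e : Edge n) → Σ (Fin m) λ g → SameEnds (coord g) e
  coord-surjective ((a , b) , a<b , inj₁ (inj₁ b≡a+1)) =
    a ↑ˡ h , proj₁ (cycle-coord a a+1<n) , trans (proj₂ (cycle-coord a a+1<n)) (sym b≡a+1)
    where
    a+1<n : suc (toℕ a) < n
    a+1<n = subst (_< n) b≡a+1 (toℕ<n b)
  coord-surjective ((a , b) , a<b , inj₁ (inj₂ (inj₁ (_ , b≡0)))) = ⊥-elim (ℕ.n≮0 (subst (toℕ a <_) b≡0 a<b))
  coord-surjective ((a , b) , a<b , inj₁ (inj₂ (inj₂ b≡a+n/2))) =
    n ↑ʳ j , trans (proj₁ (chord-coord j)) j≡a , trans (proj₂ (chord-coord j)) (trans (cong (_+ℕ h) j≡a) (sym b≡a+h))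
    where
    b≡a+h : toℕ b ≡ toℕ a +ℕ h
    b≡a+h = trans b≡a+n/2 (cong (toℕ a +ℕ_) n/2≡h)
    a<h : toℕ a < h
    a<h = ℕ.+-cancelʳ-< h (toℕ a) h (subst (_< n) b≡a+h (toℕ<n b))
    j : Fin h
    j = fromℕ< a<h
    j≡a : toℕ j ≡ toℕ a
    j≡a = toℕ-fromℕ< a<h
  coord-surjective ((a , b) , a<b , inj₂ (inj₁ a≡b+1)) = ⊥-elim (ℕ.<-asym a<b (subst (toℕ b <_) (sym a≡b+1) (ℕ.n<1+n (toℕ b))))
  coord-surjective ((a , b) , a<b , inj₂ (inj₂ (inj₁ (b≡n∸1 , a≡0)))) =
    last-vertex ↑ˡ h , trans (proj₁ (wrap-coord last-vertex toℕ-last)) (sym a≡0) , trans (proj₂ (wrap-coord last-vertex toℕ-last)) (sym b≡n∸1)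
  coord-surjective ((a , b) , a<b , inj₂ (inj₂ (inj₂ a≡b+n/2))) =
    ⊥-elim (ℕ.<-asym a<b (subst (toℕ b <_) (sym a≡b+h) (ℕ.m<m+n (toℕ b) (s≤s z≤n))))
    where
    a≡b+h : toℕ a ≡ toℕ b +ℕ h
    a≡b+h = trans a≡b+n/2 (cong (toℕ b +ℕ_) n/2≡h)

  cutVec-same-ends : ∀ S {e e′ : Edge n} → SameEnds e e′ → cutVec S e ≡ cutVec S e′
  cutVec-same-ends S {e} {e′} (l≡ , u≡) = begin
    cutVec S e                                              ≡⟨ cutVec≡toQ S e ⟩
    toQ (S (proj₁ (proj₁ e)) xor S (proj₂ (proj₁ e)))       ≡⟨ cong₂ (λ i j → toQ (S i xor S j)) (toℕ-injective l≡) (toℕ-injective u≡) ⟩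
    toQ (S (proj₁ (proj₁ e′)) xor S (proj₂ (proj₁ e′)))     ≡⟨ sym (cutVec≡toQ S e′) ⟩
    cutVec S e′                                             ∎
    where open ≡-Reasoning

  -- Facet certificates

  private
    ∧-false : ∀ {p q} → (p ≡ true → q ≡ true → ⊥) → p ∧ q ≡ false
    ∧-false {false} _ = refl
    ∧-false {true} {false} _ = refl
    ∧-false {true} {true} contra = ⊥-elim (contra refl refl)

    ends-match : ∀ g g′ →
      let x = lower (coord g) ; y = upper (coord g) ; x′ = lower (coord g′) ; y′ = upper (coord g′) in
      toQ (((x′ ≡ᵇ x) ∧ (y′ ≡ᵇ y)) ∨ ((x′ ≡ᵇ y) ∧ (y′ ≡ᵇ x))) ≡ unit g g′
    ends-match g g′ = by-decision (g Fin.≟ g′)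
      where
      x = lower (coord g)
      y = upper (coord g)
      x′ = lower (coord g′)
      y′ = upper (coord g′)
      by-decision : (d : Dec (g ≡ g′)) → toQ (((x′ ≡ᵇ x) ∧ (y′ ≡ᵇ y)) ∨ ((x′ ≡ᵇ y) ∧ (y′ ≡ᵇ x))) ≡ (if does d then 1ℚ else 0ℚ)
      by-decision (yes g≡g′) = cong (λ b → toQ (b ∨ ((x′ ≡ᵇ y) ∧ (y′ ≡ᵇ x))))
        (cong₂ _∧_ (trans (cong (λ z → lower (coord z) ≡ᵇ x) (sym g≡g′)) (≡ᵇ-refl x))
                   (trans (cong (λ z → upper (coord z) ≡ᵇ y) (sym g≡g′)) (≡ᵇ-refl y)))
      by-decision (no g≢g′) = cong toQ (cong₂ _∨_
        (∧-false (λ l≡ u≡ → g≢g′ (coord-injective g g′ (sym (≡ᵇ⇒≡ x′ x l≡) , sym (≡ᵇ⇒≡ y′ y u≡)))))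
        (∧-false (λ l≡ u≡ → ℕ.<-asym (lower<upper (coord g)) (subst₂ _<_ (≡ᵇ⇒≡ x′ y l≡) (≡ᵇ⇒≡ y′ x u≡) (lower<upper (coord g′))))))

  cut-at : ∀ (f : ℕ → Bool) g {x y bx by} → lower (coord g) ≡ x → upper (coord g) ≡ y → f x ≡ bx → f y ≡ by →
           cutVec (f ∘ toℕ) (coord g) ≡ toQ (bx xor by)
  cut-at f g l≡ u≡ fx fy =
    trans (cutVec-positions f (coord g)) (cong₂ (λ p q → toQ (p xor q)) (trans (cong f l≡) fx) (trans (cong f u≡) fy))

  square-unit : (g g′ : Fin m) {x y : ℕ} → lower (coord g) ≡ x → upper (coord g) ≡ y →
    {f f+x f+y f+xy : ℕ → Bool} → f x ≡ false → f y ≡ false →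
    (∀ z → f+x z ≡ insert x f z) → (∀ z → f+y z ≡ insert y f z) → (∀ z → f+xy z ≡ insert y f+x z) →
    unit g g′ ≡ -½ * cutVec (f ∘ toℕ) (coord g′) + (½ * cutVec (f+x ∘ toℕ) (coord g′) +
                (½ * cutVec (f+y ∘ toℕ) (coord g′) + (-½ * cutVec (f+xy ∘ toℕ) (coord g′) + 0ℚ)))
  square-unit g g′ {x} {y} refl refl {f} {f+x} {f+y} {f+xy} fx fy +x +y +xy = begin
    unit g g′                                                   ≡⟨ sym (ends-match g g′) ⟩
    t                                                           ≡⟨ solve 1 (λ t → t := con -½ :* (:- (t :+ t))) refl t ⟩
    -½ * - (t + t)                                              ≡⟨ cong (-½ *_) (sym (square-identity {f} fx fy x≢y x′ y′)) ⟩
    -½ * (cut f x′ y′ - cut (insert x f) x′ y′ - cut (insert y f) x′ y′ + cut (insert y (insert x f)) x′ y′)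
      ≡⟨ cong₂ (λ c₁ c₂ → -½ * (cut f x′ y′ - c₁ - c₂ + cut (insert y (insert x f)) x′ y′)) (sym (cut-cong +x)) (sym (cut-cong +y)) ⟩
    -½ * (cut f x′ y′ - cut f+x x′ y′ - cut f+y x′ y′ + cut (insert y (insert x f)) x′ y′)
      ≡⟨ cong (λ c₃ → -½ * (cut f x′ y′ - cut f+x x′ y′ - cut f+y x′ y′ + c₃)) (sym (cut-cong (λ z → trans (+xy z) (cong (_∨ (z ≡ᵇ y)) (+x z))))) ⟩
    -½ * (cut f x′ y′ - cut f+x x′ y′ - cut f+y x′ y′ + cut f+xy x′ y′)
      ≡⟨ solve 4 (λ c₀ c₁ c₂ c₃ → con -½ :* (c₀ :- c₁ :- c₂ :+ c₃)
                                 := con -½ :* c₀ :+ (con ½ :* c₁ :+ (con ½ :* c₂ :+ (con -½ :* c₃ :+ con 0ℚ))))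
               refl (cut f x′ y′) (cut f+x x′ y′) (cut f+y x′ y′) (cut f+xy x′ y′) ⟩
    -½ * cut f x′ y′ + (½ * cut f+x x′ y′ + (½ * cut f+y x′ y′ + (-½ * cut f+xy x′ y′ + 0ℚ)))
      ≡⟨ sym (cong₂ (λ c₀ c → -½ * c₀ + c) (cutVec-positions f (coord g′))
               (cong₂ (λ c₁ c → ½ * c₁ + c) (cutVec-positions f+x (coord g′))
                 (cong₂ (λ c₂ c₃ → ½ * c₂ + (-½ * c₃ + 0ℚ)) (cutVec-positions f+y (coord g′)) (cutVec-positions f+xy (coord g′))))) ⟩
    -½ * cutVec (f ∘ toℕ) (coord g′) + (½ * cutVec (f+x ∘ toℕ) (coord g′) +
      (½ * cutVec (f+y ∘ toℕ) (coord g′) + (-½ * cutVec (f+xy ∘ toℕ) (coord g′) + 0ℚ)))  ∎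
    where
    open +-*-Solver using (solve; _:=_; _:+_; _:*_; :-_; _:-_; con)
    x′ = lower (coord g′)
    y′ = upper (coord g′)
    t = toQ (((x′ ≡ᵇ x) ∧ (y′ ≡ᵇ y)) ∨ ((x′ ≡ᵇ y) ∧ (y′ ≡ᵇ x)))
    x≢y : x ≢ y
    x≢y x≡y = ℕ.<-irrefl x≡y (lower<upper (coord g))
    cut-cong : ∀ {f₁ f₂ : ℕ → Bool} → (∀ z → f₁ z ≡ f₂ z) → cut f₁ x′ y′ ≡ cut f₂ x′ y′
    cut-cong f₁≗f₂ = cong₂ (λ p q → toQ (p xor q)) (f₁≗f₂ x′) (f₁≗f₂ y′)

  module Face (a b : Fin n) where

    FaceBond : Set
    FaceBond = Σ (Subset n) λ S → IsBond S × (S a xor S b) ≡ true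

    IsFaceBond : (ℕ → Bool) → Set
    IsFaceBond f = IsBond (f ∘ toℕ) × (f (toℕ a) xor f (toℕ b)) ≡ true

    vec : FaceBond → Fin m → ℚ
    vec B g = cutVec (proj₁ B) (coord g)

    Combination : (Fin m → ℚ) → Set
    Combination x = Σ (Fin 4 → FaceBond) λ W → InSpan (vec ∘ W) x

    bond-combination : (B : FaceBond) → Combination (vec B)
    bond-combination B = (λ _ → B) , unit zero , λ g → sym (sum-unit {4} zero (λ _ → vec B g))

    separated : ∀ {f : ℕ → Bool} → f (toℕ a) ≡ true → f (toℕ b) ≡ false → (f (toℕ a) xor f (toℕ b)) ≡ true
    separated a∈ b∉ = cong₂ _xor_ a∈ b∉

    square-combination : (g : Fin m) {x y : ℕ} → lower (coord g) ≡ x → upper (coord g) ≡ y →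
      (f f+x f+y f+xy : ℕ → Bool) → f x ≡ false → f y ≡ false →
      (∀ z → f+x z ≡ insert x f z) → (∀ z → f+y z ≡ insert y f z) → (∀ z → f+xy z ≡ insert y f+x z) →
      IsFaceBond f → IsFaceBond f+x → IsFaceBond f+y → IsFaceBond f+xy → Combination (unit g)
    square-combination g l≡ u≡ f f+x f+y f+xy fx fy +x +y +xy B B+x B+y B+xy =
      W , α , λ g′ → square-unit g g′ l≡ u≡ fx fy +x +y +xy
      where
      W : Fin 4 → FaceBond
      W zero                   = f ∘ toℕ , B
      W (suc zero)             = f+x ∘ toℕ , B+x
      W (suc (suc zero))       = f+y ∘ toℕ , B+y
      W (suc (suc (suc zero))) = f+xy ∘ toℕ , B+xy
      α : Fin 4 → ℚ
      α zero                   = -½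
      α (suc zero)             = ½
      α (suc (suc zero))       = ½
      α (suc (suc (suc zero))) = -½

    -- The basis is assembled from 5 special bonds and |E| - 5 unit vectors, hence its size 5 + (|E| - 5).
    record FacetCertificate : Set where
      field
        face-bond   : Fin (5 +ℕ (m ∸ 5)) → FaceBond
        independent : LinearlyIndependent (λ i → cutVec (proj₁ (face-bond i)))
        off-face    : Σ (Subset n) λ S → IsBond S × (S a xor S b) ≡ false

    certificate : (G : Fin 5 → Fin m) → Increasing G → (z : Fin 5 → FaceBond) (π : Fin 5 → Fin 5) →
      LowerUnitriangular (λ c i → vec (z i) (G (π c))) → (∀ g → (∀ c → g ≢ G c) → Combination (unit g)) →
      Σ (Subset n) (λ S → IsBond S × (S a xor S b) ≡ false) → FacetCertificate
    certificate G G-increasing z π triangular unit-from-square off = record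
      { face-bond   = proj₁ basis
      ; independent = λ c c-rel → proj₂ basis c (c-rel ∘ coord)
      ; off-face    = off
      }
      where
      complement-of-G = complement G (increasing-injective G G-increasing)
      κ = proj₁ complement-of-G
      t : Fin (5 +ℕ (m ∸ 5)) → Fin m → ℚ
      t = (vec ∘ z) ++ (unit ∘ κ)
      t-independent : LinearlyIndependent t
      t-independent = independent-with-units G κ (proj₁ (proj₂ complement-of-G)) (proj₂ (proj₂ complement-of-G)) (vec ∘ z)
        (λ d rows → lower-unitriangular-nonsingular (λ c i → vec (z i) (G (π c))) triangular d (rows ∘ π))
      combination-of : ∀ x → Combination ([ vec ∘ z , unit ∘ κ ]′ x)
      combination-of (inj₁ i) = bond-combination (z i)
      combination-of (inj₂ j) = unit-from-square (κ j) (proj₂ (proj₂ complement-of-G) j)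
      blocks : ∀ x → Combination (t x)
      blocks x = subst (Combination ∘ t) (join-splitAt 5 (m ∸ 5) x) (subst Combination (sym (cong [ vec ∘ z , unit ∘ κ ]′ (splitAt-join 5 (m ∸ 5) (splitAt 5 x)))) (combination-of (splitAt 5 x)))
      basis = basis-from-blocks vec (ℕ.m≤n+m∸n m 5) t t-independent blocks

  module WrapEdge where

    open Face first-vertex last-vertex

    private
      face-arcs : ∀ p q r s → IsBond (Arcs p q r s) → 1 ≤ p → arcs p q r s (n ∸ 1) ≡ false → IsFaceBond (arcs p q r s)
      face-arcs p q r s bond 1≤p last∉ =
        bond , separated {arcs p q r s} (trans (cong (arcs p q r s) toℕ-first) (arcs-left 1≤p))
                                        (trans (cong (arcs p q r s) toℕ-last) last∉)
        where open ArcsMembership p q r s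

      interval-face : ∀ {p} → 1 ≤ p → p ≤ n ∸ 1 → IsFaceBond (arcs p p p n)
      interval-face {p} 1≤p p≤n∸1 =
        face-arcs p p p n (interval-bond 1≤p (ℕ.≤-<-trans p≤n∸1 n∸1<n) ℕ.≤-refl) 1≤p
                  (arcs-second-gap ℕ.≤-refl ℕ.≤-refl p≤n∸1 n∸1<n)
        where open ArcsMembership p p p n

      -- the middle arc reaches vertex h, which the chord {0, h} ties to vertex 0
      chord-linked : ∀ {p q r} → 1 ≤ p → p ≤ suc q → suc q ≤ h → h < r → r ≤ q +ℕ h → IsFaceBond (arcs p (suc q) r n)
      chord-linked {p} {q} {r} 1≤p p≤q+1 q<h h<r r≤q+h =
        face-arcs p (suc q) r n (arcs-bond 1≤p p≤q+1 q+1≤r (ℕ.<⇒≤ r<n) ℕ.≤-refl (inj₂ r<n) middle-link gap-link) 1≤p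
                  (arcs-second-gap p≤q+1 q+1≤r (ℕ.≤-pred r<n) n∸1<n)
        where
        open ArcsMembership p (suc q) r n
        q+h<n : q +ℕ h < n
        q+h<n = ℕ.+-monoˡ-< h q<h
        r<n : r < n
        r<n = ℕ.≤-<-trans r≤q+h q+h<n
        q+1≤r : suc q ≤ r
        q+1≤r = ℕ.≤-trans q<h (ℕ.<⇒≤ h<r)
        middle-link : suc q < r → Joins (OutsideMiddle {p} {suc q} {r} {n}) (Interval (suc q) r)
        middle-link _ = joins-at (s≤s z≤n) h<n (adj-vertex-chord (s≤s z≤n) h<n) (inj₁ 1≤p) (q<h , h<r)
        gap-link : p < suc q → r < n → Joins (Interval p (suc q)) (Interval r n)
        gap-link p<q+1 _ = joins-at q<n q+h<n (adj-vertex-chord q<n q+h<n) (ℕ.≤-pred p<q+1 , ℕ.n<1+n q) (r≤q+h , q+h<n)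
          where
          q<n : q < n
          q<n = ℕ.<-trans q<h h<n

      -- the middle arc starts at h - 1 or beyond, and the chord {h - 1, n - 1} links the gaps
      beyond-chord : ∀ {q r} → h ∸ 1 ≤ q → q ≤ r → r ≤ n ∸ 1 → IsFaceBond (arcs (h ∸ 1) q r n)
      beyond-chord {q} {r} h∸1≤q q≤r r≤n∸1 =
        face-arcs (h ∸ 1) q r n (arcs-bond (s≤s z≤n) h∸1≤q q≤r (ℕ.≤-trans r≤n∸1 (ℕ.n≤1+n (n ∸ 1))) ℕ.≤-refl (inj₂ (s≤s r≤n∸1)) middle-link gap-link)
                  (s≤s z≤n) (arcs-second-gap h∸1≤q q≤r r≤n∸1 n∸1<n)
        where
        open ArcsMembership (h ∸ 1) q r n
        h∸1<n : h ∸ 1 < n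
        h∸1<n = ℕ.<-trans (ℕ.n<1+n (h ∸ 1)) h<n
        middle-link : q < r → Joins (OutsideMiddle {h ∸ 1} {q} {r} {n}) (Interval q r)
        middle-link q<r with ℕ.m≤n⇒m<n∨m≡n h∸1≤q
        ... | inj₂ h∸1≡q = joins-at (ℕ.<-trans (ℕ.n<1+n (h ∸ 2)) h∸1<n) h∸1<n (adj-vertex-suc (ℕ.<-trans (ℕ.n<1+n (h ∸ 2)) h∸1<n) h∸1<n)
                                    (inj₁ (ℕ.n<1+n (h ∸ 2))) (ℕ.≤-reflexive (sym h∸1≡q) , subst (_< r) (sym h∸1≡q) q<r)
        ... | inj₁ h≤q = joins-at q∸h<n q′<n (adj-vertex-chord q∸h<n q′<n) (inj₁ q∸h<h∸1)
                                  (subst (λ x → Interval q r x) (sym q∸h+h≡q) (ℕ.≤-refl , q<r))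
          where
          q∸h+h≡q : (q ∸ h) +ℕ h ≡ q
          q∸h+h≡q = ℕ.m∸n+n≡m h≤q
          q<n∸1 : q < n ∸ 1
          q<n∸1 = ℕ.<-≤-trans q<r r≤n∸1
          q∸h<h∸1 : q ∸ h < h ∸ 1
          q∸h<h∸1 = subst (q ∸ h <_) (trans (cong (_∸ h) n∸1≡h∸1+h) (ℕ.m+n∸n≡m (h ∸ 1) h)) (ℕ.∸-monoˡ-< q<n∸1 h≤q)
          q′<n : (q ∸ h) +ℕ h < n
          q′<n = subst (_< n) (sym q∸h+h≡q) (ℕ.<-trans q<n∸1 n∸1<n)
          q∸h<n : q ∸ h < n
          q∸h<n = ℕ.≤-<-trans (ℕ.m≤m+n (q ∸ h) h) q′<n
        gap-link : h ∸ 1 < q → r < n → Joins (Interval (h ∸ 1) q) (Interval r n)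
        gap-link h∸1<q _ = joins-at h∸1<n (subst (_< n) n∸1≡h∸1+h n∸1<n) (adj-vertex-chord h∸1<n (subst (_< n) n∸1≡h∸1+h n∸1<n))
                                    (ℕ.≤-refl , h∸1<q) (subst (r ≤_) n∸1≡h∸1+h r≤n∸1 , subst (_< n) n∸1≡h∸1+h n∸1<n)

      near-square : ∀ g {k} → lower (coord g) ≡ k → upper (coord g) ≡ suc k → 1 ≤ k → 2 +ℕ k ≤ h → Combination (unit g)
      near-square g {k} l≡ u≡ 1≤k k+2≤h =
        square-combination g l≡ u≡ (arcs k (2 +ℕ k) (suc h) n) (arcs (suc k) (2 +ℕ k) (suc h) n)
                             (arcs k (suc k) (suc h) n) (arcs (suc k) (suc k) (suc h) n)
          (arcs-first-gap k+2≤h+1 h+1≤n ℕ.≤-refl (ℕ.≤-trans (ℕ.n<1+n k) (ℕ.n≤1+n (suc k))))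
          (arcs-first-gap k+2≤h+1 h+1≤n (ℕ.n≤1+n k) (ℕ.n<1+n (suc k)))
          (grow-left k (2 +ℕ k) (suc h) n)
          (λ z → grow-middle-left k (suc k) (suc h) n z (s≤s k+1≤h))
          (λ z → grow-middle-left (suc k) (suc k) (suc h) n z (s≤s k+1≤h))
          (near 1≤k (ℕ.≤-trans (ℕ.n≤1+n k) (ℕ.n≤1+n (suc k))) k+2≤h (s≤s z≤n))
          (near (s≤s z≤n) (ℕ.n≤1+n (suc k)) k+2≤h (s≤s z≤n))
          (near 1≤k (ℕ.n≤1+n k) k+1≤h 1≤k)
          (near (s≤s z≤n) ℕ.≤-refl k+1≤h 1≤k)
        where
        open ArcsMembership k (2 +ℕ k) (suc h) n
        k+1≤h : suc k ≤ h
        k+1≤h = ℕ.≤-trans (ℕ.n≤1+n (suc k)) k+2≤h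
        k+2≤h+1 : 2 +ℕ k ≤ suc h
        k+2≤h+1 = ℕ.≤-trans k+2≤h (ℕ.n≤1+n h)
        h+1≤n : suc h ≤ n
        h+1≤n = h<n
        near : ∀ {p q} → 1 ≤ p → p ≤ suc q → suc q ≤ h → 1 ≤ q → IsFaceBond (arcs p (suc q) (suc h) n)
        near 1≤p p≤q+1 q<h 1≤q = chord-linked 1≤p p≤q+1 q<h (ℕ.n<1+n h) (ℕ.+-monoˡ-≤ h 1≤q)

      far-square : ∀ g {k} → lower (coord g) ≡ k → upper (coord g) ≡ suc k → h ≤ suc k → 3 +ℕ k ≤ n → Combination (unit g)
      far-square g {k} l≡ u≡ h≤k+1 k+3≤n =
        square-combination g l≡ u≡ (arcs (h ∸ 1) k k n) (arcs (h ∸ 1) k (suc k) n)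
                             (arcs (h ∸ 1) (suc k) (2 +ℕ k) n) (arcs (h ∸ 1) k (2 +ℕ k) n)
          (arcs-second-gap h∸1≤k ℕ.≤-refl ℕ.≤-refl k<n)
          (arcs-second-gap h∸1≤k ℕ.≤-refl (ℕ.n≤1+n k) (ℕ.<-trans (s≤s (ℕ.n<1+n k)) k+3≤n))
          (λ z → grow-middle-right (h ∸ 1) k k n z ℕ.≤-refl)
          (λ z → trans (grow-middle-right (h ∸ 1) (suc k) (suc k) n z ℕ.≤-refl)
                       (cong (_∨ (z ≡ᵇ suc k)) (empty-middle (h ∸ 1) (suc k) k n z)))
          (λ z → grow-middle-right (h ∸ 1) k (suc k) n z (ℕ.n≤1+n k))
          (beyond-chord h∸1≤k ℕ.≤-refl (ℕ.≤-trans (ℕ.n≤1+n k) k+1≤n∸1))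
          (beyond-chord h∸1≤k (ℕ.n≤1+n k) k+1≤n∸1)
          (beyond-chord (ℕ.≤-trans h∸1≤k (ℕ.n≤1+n k)) (ℕ.n≤1+n (suc k)) k+2≤n∸1)
          (beyond-chord h∸1≤k (ℕ.≤-trans (ℕ.n≤1+n k) (ℕ.n≤1+n (suc k))) k+2≤n∸1)
        where
        open ArcsMembership (h ∸ 1) k k n
        h∸1≤k : h ∸ 1 ≤ k
        h∸1≤k = ℕ.≤-pred h≤k+1
        k+2≤n∸1 : 2 +ℕ k ≤ n ∸ 1
        k+2≤n∸1 = ℕ.≤-pred k+3≤n
        k+1≤n∸1 : suc k ≤ n ∸ 1
        k+1≤n∸1 = ℕ.≤-trans (ℕ.n≤1+n (suc k)) k+2≤n∸1
        k<n : k < n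
        k<n = ℕ.<-trans (ℕ.n<1+n k) (ℕ.≤-<-trans k+1≤n∸1 n∸1<n)

      chord-square : ∀ g {k} → lower (coord g) ≡ k → upper (coord g) ≡ k +ℕ h → 1 ≤ k → 2 +ℕ k ≤ h → Combination (unit g)
      chord-square g {k} l≡ u≡ 1≤k k+2≤h =
        square-combination g l≡ u≡ (arcs k h (k +ℕ h) n) (arcs (suc k) h (k +ℕ h) n)
                             (arcs k h (suc (k +ℕ h)) n) (arcs (suc k) h (suc (k +ℕ h)) n)
          (arcs-first-gap h≤k+h (ℕ.<⇒≤ k+h<n) ℕ.≤-refl k<h)
          (arcs-second-gap (ℕ.<⇒≤ k<h) h≤k+h ℕ.≤-refl k+h<n)
          (grow-left k h (k +ℕ h) n)
          (λ z → grow-middle-right k h (k +ℕ h) n z h≤k+h)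
          (λ z → grow-middle-right (suc k) h (k +ℕ h) n z h≤k+h)
          (chord-linked 1≤k (ℕ.<⇒≤ k<h) ℕ.≤-refl h<k+h k+h≤h∸1+h)
          (chord-linked (s≤s z≤n) k<h ℕ.≤-refl h<k+h k+h≤h∸1+h)
          (chord-linked 1≤k (ℕ.<⇒≤ k<h) ℕ.≤-refl (ℕ.<-trans h<k+h (ℕ.n<1+n (k +ℕ h))) k+h+1≤h∸1+h)
          (chord-linked (s≤s z≤n) k<h ℕ.≤-refl (ℕ.<-trans h<k+h (ℕ.n<1+n (k +ℕ h))) k+h+1≤h∸1+h)
        where
        open ArcsMembership k h (k +ℕ h) n
        k<h : k < h
        k<h = ℕ.≤-trans (ℕ.n≤1+n (suc k)) k+2≤h
        h≤k+h : h ≤ k +ℕ h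
        h≤k+h = ℕ.m≤n+m h k
        h<k+h : h < k +ℕ h
        h<k+h = ℕ.+-monoˡ-≤ h 1≤k
        k+h<n : k +ℕ h < n
        k+h<n = ℕ.+-monoˡ-< h k<h
        k+h+1≤h∸1+h : suc (k +ℕ h) ≤ (h ∸ 1) +ℕ h
        k+h+1≤h∸1+h = ℕ.+-monoˡ-≤ h (ℕ.≤-pred k+2≤h)
        k+h≤h∸1+h : k +ℕ h ≤ (h ∸ 1) +ℕ h
        k+h≤h∸1+h = ℕ.≤-trans (ℕ.n≤1+n (k +ℕ h)) k+h+1≤h∸1+h

      n∸2<n : n ∸ 2 < n
      n∸2<n = ℕ.<-trans (ℕ.n<1+n (n ∸ 2)) n∸1<n

      -- the five edges meeting {0, n - 1}, by increasing coordinate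
      special : Fin 5 → Fin m
      special zero                         = first-vertex ↑ˡ h
      special (suc zero)                   = vertex (n ∸ 2) n∸2<n ↑ˡ h
      special (suc (suc zero))             = last-vertex ↑ˡ h
      special (suc (suc (suc zero)))       = n ↑ʳ zero
      special (suc (suc (suc (suc zero)))) = n ↑ʳ Fin.fromℕ (h ∸ 1)

      special-increasing : Increasing special
      special-increasing zero = subst (0 <_) (sym (trans (toℕ-↑ˡ _ h) (toℕ-vertex n∸2<n))) (s≤s z≤n)
      special-increasing (suc zero) =
        subst₂ _<_ (sym (trans (toℕ-↑ˡ _ h) (toℕ-vertex n∸2<n))) (sym (trans (toℕ-↑ˡ _ h) toℕ-last)) (ℕ.n<1+n (n ∸ 2))
      special-increasing (suc (suc zero)) =
        subst₂ _<_ (sym (trans (toℕ-↑ˡ _ h) toℕ-last)) (sym (toℕ-↑ʳ n zero)) (ℕ.≤-trans n∸1<n (ℕ.m≤m+n n 0))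
      special-increasing (suc (suc (suc zero))) =
        subst₂ _<_ (sym (toℕ-↑ʳ n zero)) (sym (toℕ-↑ʳ n (Fin.fromℕ (h ∸ 1)))) (ℕ.+-monoʳ-< n (subst (0 <_) (sym (toℕ-fromℕ (h ∸ 1))) (s≤s z≤n)))

      cycle-case : (i : Fin n) → suc (toℕ i) < n → toℕ i ≢ 0 → toℕ i ≢ n ∸ 2 → Combination (unit (i ↑ˡ h))
      cycle-case i i+1<n i≢0 i≢n∸2 = by-position (2 +ℕ toℕ i ℕ.≤? h)
        where
        by-position : Dec (2 +ℕ toℕ i ≤ h) → Combination (unit (i ↑ˡ h))
        by-position (yes i+2≤h) =
          near-square (i ↑ˡ h) (proj₁ (cycle-coord i i+1<n)) (proj₂ (cycle-coord i i+1<n)) (ℕ.n≢0⇒n>0 i≢0) i+2≤h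
        by-position (no i+2≰h) =
          far-square (i ↑ˡ h) (proj₁ (cycle-coord i i+1<n)) (proj₂ (cycle-coord i i+1<n))
                     (ℕ.≤-pred (ℕ.≰⇒> i+2≰h)) (ℕ.≤∧≢⇒< i+1<n (λ i+2≡n → i≢n∸2 (cong (_∸ 2) i+2≡n)))

      unit-from-square : ∀ g → (∀ c → g ≢ special c) → Combination (unit g)
      unit-from-square g = by-view (coord-view g)
        where
        by-view : ∀ {g} → CoordView g → (∀ c → g ≢ special c) → Combination (unit g)
        by-view (cycle i i+1<n) ordinary = cycle-case i i+1<n
          (λ i≡0 → ordinary zero (cong (_↑ˡ h) (toℕ-injective (trans i≡0 (sym toℕ-first)))))
          (λ i≡n∸2 → ordinary (suc zero) (cong (_↑ˡ h) (toℕ-injective (trans i≡n∸2 (sym (toℕ-vertex n∸2<n))))))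
        by-view (wrap i i≡n∸1) ordinary =
          contradiction (cong (_↑ˡ h) (toℕ-injective (trans i≡n∸1 (sym toℕ-last)))) (ordinary (suc (suc zero)))
        by-view (chord j) ordinary = chord-square (n ↑ʳ j) (proj₁ (chord-coord j)) (proj₂ (chord-coord j))
          (ℕ.n≢0⇒n>0 (λ j≡0 → ordinary (suc (suc (suc zero))) (cong (n ↑ʳ_) (toℕ-injective {i = j} {j = zero} j≡0))))
          (ℕ.≤∧≢⇒< (toℕ<n j) (λ j+1≡h → ordinary (suc (suc (suc (suc zero))))
            (cong (n ↑ʳ_) (toℕ-injective {i = j} {j = Fin.fromℕ (h ∸ 1)} (trans (cong (_∸ 1) j+1≡h) (sym (toℕ-fromℕ (h ∸ 1))))))))

      n∸2≡h∸2+h : n ∸ 2 ≡ (h ∸ 2) +ℕ h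
      n∸2≡h∸2+h = ℕ.+-∸-comm {h} h {2} (s≤s (s≤s z≤n))

      h+1≤n∸2 : suc h ≤ n ∸ 2
      h+1≤n∸2 = subst (suc h ≤_) (sym n∸2≡h∸2+h) (ℕ.+-monoˡ-≤ h {1} {h ∸ 2} (s≤s z≤n))

      h+1≤n∸1 : suc h ≤ n ∸ 1
      h+1≤n∸1 = ℕ.≤-trans h+1≤n∸2 (ℕ.n≤1+n (n ∸ 2))

      h∸1+h<n : (h ∸ 1) +ℕ h < n
      h∸1+h<n = subst (_< n) n∸1≡h∸1+h n∸1<n

      h+1≤h∸1+h : suc h ≤ (h ∸ 1) +ℕ h
      h+1≤h∸1+h = ℕ.+-monoˡ-≤ h {1} {h ∸ 1} (s≤s z≤n)

      special-bond : Fin 5 → FaceBond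
      special-bond zero                         = Arcs 1 1 1 n , interval-face (s≤s z≤n) (s≤s z≤n)
      special-bond (suc zero)                   = Arcs (n ∸ 1) (n ∸ 1) (n ∸ 1) n , interval-face (s≤s z≤n) ℕ.≤-refl
      special-bond (suc (suc zero))             = Arcs 2 2 2 n , interval-face (s≤s z≤n) (s≤s (s≤s z≤n))
      special-bond (suc (suc (suc zero)))       = Arcs (suc h) (suc h) (suc h) n , interval-face (s≤s z≤n) h+1≤n∸1
      special-bond (suc (suc (suc (suc zero)))) =
        Arcs 2 h (suc h) n , chord-linked (s≤s z≤n) (s≤s (s≤s z≤n)) ℕ.≤-refl (ℕ.n<1+n h) h+1≤h∸1+h

      row-order : Fin 5 → Fin 5
      row-order zero                         = zero
      row-order (suc zero)                   = suc zero
      row-order (suc (suc zero))             = suc (suc (suc zero))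
      row-order (suc (suc (suc zero)))       = suc (suc (suc (suc zero)))
      row-order (suc (suc (suc (suc zero)))) = suc (suc zero)

      ends₀ : lower (coord (special zero)) ≡ 0 × upper (coord (special zero)) ≡ 1
      ends₀ = cycle-coord first-vertex (s≤s (s≤s z≤n))

      ends₁ : lower (coord (special (suc zero))) ≡ n ∸ 2 × upper (coord (special (suc zero))) ≡ n ∸ 1
      ends₁ = trans (proj₁ (cycle-coord v (subst (λ x → suc x < n) (sym (toℕ-vertex n∸2<n)) n∸1<n))) (toℕ-vertex n∸2<n) ,
              trans (proj₂ (cycle-coord v (subst (λ x → suc x < n) (sym (toℕ-vertex n∸2<n)) n∸1<n))) (cong suc (toℕ-vertex n∸2<n))
        where v = vertex (n ∸ 2) n∸2<n

      ends₂ : lower (coord (special (suc (suc zero)))) ≡ 0 × upper (coord (special (suc (suc zero)))) ≡ n ∸ 1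
      ends₂ = wrap-coord last-vertex toℕ-last

      ends₃ : lower (coord (special (suc (suc (suc zero))))) ≡ 0 × upper (coord (special (suc (suc (suc zero))))) ≡ h
      ends₃ = chord-coord zero

      ends₄ : lower (coord (special (suc (suc (suc (suc zero)))))) ≡ h ∸ 1 ×
              upper (coord (special (suc (suc (suc (suc zero)))))) ≡ (h ∸ 1) +ℕ h
      ends₄ = trans (proj₁ (chord-coord (Fin.fromℕ (h ∸ 1)))) (toℕ-fromℕ (h ∸ 1)) ,
              trans (proj₂ (chord-coord (Fin.fromℕ (h ∸ 1)))) (cong (_+ℕ h) (toℕ-fromℕ (h ∸ 1)))

      triangular : LowerUnitriangular (λ c i → vec (special-bond i) (special (row-order c)))
      triangular =
        cut-at (arcs 1 1 1 n) (special zero) (proj₁ ends₀) (proj₂ ends₀) (I.arcs-left (s≤s z≤n)) (I.arcs-second-gap ℕ.≤-refl ℕ.≤-refl ℕ.≤-refl (s≤s (s≤s z≤n))) ,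
        (λ { zero → cut-at (arcs (n ∸ 1) (n ∸ 1) (n ∸ 1) n) (special zero) (proj₁ ends₀) (proj₂ ends₀) (L.arcs-left (s≤s z≤n)) (L.arcs-left (s≤s (s≤s z≤n)))
           ; (suc zero) → cut-at (arcs 2 2 2 n) (special zero) (proj₁ ends₀) (proj₂ ends₀) (T.arcs-left (s≤s z≤n)) (T.arcs-left (s≤s (s≤s z≤n)))
           ; (suc (suc zero)) → cut-at (arcs (suc h) (suc h) (suc h) n) (special zero) (proj₁ ends₀) (proj₂ ends₀) (H.arcs-left (s≤s z≤n)) (H.arcs-left (s≤s (s≤s z≤n)))
           ; (suc (suc (suc zero))) → cut-at (arcs 2 h (suc h) n) (special zero) (proj₁ ends₀) (proj₂ ends₀) (X.arcs-left (s≤s z≤n)) (X.arcs-left (s≤s (s≤s z≤n))) }) ,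
        ( cut-at (arcs (n ∸ 1) (n ∸ 1) (n ∸ 1) n) (special (suc zero)) (proj₁ ends₁) (proj₂ ends₁) (L.arcs-left (ℕ.n<1+n (n ∸ 2))) (L.arcs-second-gap ℕ.≤-refl ℕ.≤-refl ℕ.≤-refl n∸1<n) ,
          (λ { zero → cut-at (arcs 2 2 2 n) (special (suc zero)) (proj₁ ends₁) (proj₂ ends₁) (T.arcs-second-gap ℕ.≤-refl ℕ.≤-refl 2≤n∸2 n∸2<n) (T.arcs-second-gap ℕ.≤-refl ℕ.≤-refl 2≤n∸1 n∸1<n)
             ; (suc zero) → cut-at (arcs (suc h) (suc h) (suc h) n) (special (suc zero)) (proj₁ ends₁) (proj₂ ends₁) (H.arcs-second-gap ℕ.≤-refl ℕ.≤-refl h+1≤n∸2 n∸2<n) (H.arcs-second-gap ℕ.≤-refl ℕ.≤-refl h+1≤n∸1 n∸1<n)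
             ; (suc (suc zero)) → cut-at (arcs 2 h (suc h) n) (special (suc zero)) (proj₁ ends₁) (proj₂ ends₁) (X.arcs-second-gap 2≤h (ℕ.n≤1+n h) h+1≤n∸2 n∸2<n) (X.arcs-second-gap 2≤h (ℕ.n≤1+n h) h+1≤n∸1 n∸1<n) }) ,
          ( cut-at (arcs 2 2 2 n) (special (suc (suc (suc zero)))) (proj₁ ends₃) (proj₂ ends₃) (T.arcs-left (s≤s z≤n)) (T.arcs-second-gap ℕ.≤-refl ℕ.≤-refl 2≤h h<n) ,
            (λ { zero → cut-at (arcs (suc h) (suc h) (suc h) n) (special (suc (suc (suc zero)))) (proj₁ ends₃) (proj₂ ends₃) (H.arcs-left (s≤s z≤n)) (H.arcs-left (ℕ.n<1+n h))
               ; (suc zero) → cut-at (arcs 2 h (suc h) n) (special (suc (suc (suc zero)))) (proj₁ ends₃) (proj₂ ends₃) (X.arcs-left (s≤s z≤n)) (X.arcs-middle ℕ.≤-refl (ℕ.n<1+n h)) }) ,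
            ( cut-at (arcs (suc h) (suc h) (suc h) n) (special (suc (suc (suc (suc zero))))) (proj₁ ends₄) (proj₂ ends₄) (H.arcs-left (ℕ.<-trans (ℕ.n<1+n (h ∸ 1)) (ℕ.n<1+n h))) (H.arcs-second-gap ℕ.≤-refl ℕ.≤-refl h+1≤h∸1+h h∸1+h<n) ,
              (λ { zero → cut-at (arcs 2 h (suc h) n) (special (suc (suc (suc (suc zero))))) (proj₁ ends₄) (proj₂ ends₄) (X.arcs-first-gap (ℕ.n≤1+n h) h<n (s≤s (s≤s z≤n)) (ℕ.n<1+n (h ∸ 1))) (X.arcs-second-gap 2≤h (ℕ.n≤1+n h) h+1≤h∸1+h h∸1+h<n) }) ,
              ( cut-at (arcs 2 h (suc h) n) (special (suc (suc zero))) (proj₁ ends₂) (proj₂ ends₂) (X.arcs-left (s≤s z≤n)) (X.arcs-second-gap 2≤h (ℕ.n≤1+n h) h+1≤n∸1 n∸1<n) ,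
                (λ ()) , tt ) ) ) )
        where
        module I = ArcsMembership 1 1 1 n
        module L = ArcsMembership (n ∸ 1) (n ∸ 1) (n ∸ 1) n
        module T = ArcsMembership 2 2 2 n
        module H = ArcsMembership (suc h) (suc h) (suc h) n
        module X = ArcsMembership 2 h (suc h) n
        2≤h : 2 ≤ h
        2≤h = s≤s (s≤s z≤n)
        2≤n∸2 : 2 ≤ n ∸ 2
        2≤n∸2 = ℕ.≤-trans 2≤h (ℕ.≤-trans (ℕ.n≤1+n h) h+1≤n∸2)
        2≤n∸1 : 2 ≤ n ∸ 1
        2≤n∸1 = ℕ.≤-trans 2≤n∸2 (ℕ.n≤1+n (n ∸ 2))

      off-face-bond : Σ (Subset n) λ S → IsBond S × (S first-vertex xor S last-vertex) ≡ false
      off-face-bond = Arcs 1 1 1 2 , interval-bond (s≤s z≤n) (s≤s (s≤s z≤n)) (s≤s (s≤s z≤n)) ,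
        cong₂ _xor_ (ArcsMembership.arcs-left 1 1 1 2 (s≤s z≤n)) (trans (cong (arcs 1 1 1 2) toℕ-last) (ArcsMembership.arcs-right 1 1 1 2 {n ∸ 1} (s≤s (s≤s z≤n))))

    wrap-certificate : FacetCertificate
    wrap-certificate = certificate special special-increasing special-bond row-order triangular unit-from-square off-face-bond

  module ChordEdge where

    chord-vertex : Fin n
    chord-vertex = vertex h h<n

    open Face first-vertex chord-vertex

    private
      face-arcs : ∀ p q r s → IsBond (Arcs p q r s) → 1 ≤ p → arcs p q r s h ≡ false → IsFaceBond (arcs p q r s)
      face-arcs p q r s bond 1≤p h∉ =
        bond , separated {arcs p q r s} (trans (cong (arcs p q r s) toℕ-first) (arcs-left 1≤p))
                                        (trans (cong (arcs p q r s) (toℕ-vertex h<n)) h∉)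
        where open ArcsMembership p q r s

      interval-face : ∀ {p s} → 1 ≤ p → p ≤ h → h < s → s ≤ n → IsFaceBond (arcs p p p s)
      interval-face {p} {s} 1≤p p≤h h<s s≤n =
        face-arcs p p p s (interval-bond 1≤p (ℕ.≤-<-trans p≤h h<s) s≤n) 1≤p (arcs-second-gap ℕ.≤-refl ℕ.≤-refl p≤h h<s)
        where open ArcsMembership p p p s

      -- the middle arc lies below h; vertex 0 and the arc [h + 2, n) hold on to it through 0–1 or through chords
      below-chord : ∀ {q r} → 1 ≤ q → q ≤ r → r ≤ h → IsFaceBond (arcs 1 q r (2 +ℕ h))
      below-chord {q} {r} 1≤q q≤r r≤h =
        face-arcs 1 q r (2 +ℕ h) (arcs-bond (s≤s z≤n) 1≤q q≤r r≤h+2 h+2≤n (inj₂ (s≤s (ℕ.≤-trans r≤h (ℕ.n≤1+n h)))) middle-link gap-link)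
                  (s≤s z≤n) (arcs-second-gap 1≤q q≤r r≤h (ℕ.≤-trans (ℕ.n<1+n h) (ℕ.n≤1+n (suc h))))
        where
        open ArcsMembership 1 q r (2 +ℕ h)
        r≤h+2 : r ≤ 2 +ℕ h
        r≤h+2 = ℕ.≤-trans r≤h (ℕ.≤-trans (ℕ.n≤1+n h) (ℕ.n≤1+n (suc h)))
        h+2≤n : 2 +ℕ h ≤ n
        h+2≤n = ℕ.+-monoˡ-≤ h {2} {h} (s≤s (s≤s z≤n))
        middle-link : q < r → Joins (OutsideMiddle {1} {q} {r} {2 +ℕ h}) (Interval q r)
        middle-link q<r with ℕ.m≤n⇒m<n∨m≡n 1≤q
        ... | inj₂ 1≡q = joins-at (s≤s z≤n) 1<n (adj-vertex-suc (s≤s z≤n) 1<n) (inj₁ (s≤s z≤n))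
                                  (ℕ.≤-reflexive (sym 1≡q) , subst (_< r) (sym 1≡q) q<r)
          where
          1<n : 1 < n
          1<n = s≤s (s≤s z≤n)
        ... | inj₁ 2≤q = joins-at q+h<n q<n (Adj-sym (adj-vertex-chord q<n q+h<n)) (inj₂ (ℕ.+-monoˡ-≤ h 2≤q)) (ℕ.≤-refl , q<r)
          where
          q<h : q < h
          q<h = ℕ.<-≤-trans q<r r≤h
          q<n : q < n
          q<n = ℕ.<-trans q<h h<n
          q+h<n : q +ℕ h < n
          q+h<n = ℕ.+-monoˡ-< h q<h
        gap-link : 1 < q → r < 2 +ℕ h → Joins (Interval 1 q) (Interval r (2 +ℕ h))
        gap-link 1<q _ = joins-at (s≤s (s≤s z≤n)) (ℕ.<-≤-trans (ℕ.n<1+n (suc h)) h+2≤n) (adj-vertex-chord (s≤s (s≤s z≤n)) (ℕ.<-≤-trans (ℕ.n<1+n (suc h)) h+2≤n))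
                                  (ℕ.≤-refl , 1<q) (ℕ.≤-trans r≤h (ℕ.n≤1+n h) , ℕ.n<1+n (suc h))

      -- for the cycle edge {x + h, x + h + 1}: the chords {x, x + h} and {x + 1, x + h + 1} tie the arcs together
      above-chord : ∀ {x s} → 1 ≤ x → 2 +ℕ x ≤ h → suc (x +ℕ h) ≤ s → s ≤ n → IsFaceBond (arcs (suc x) (x +ℕ h) (suc (x +ℕ h)) s)
      above-chord {x} {s} 1≤x x+2≤h k+1≤s s≤n =
        face-arcs (suc x) k (suc k) s (arcs-bond (s≤s z≤n) x+1≤k (ℕ.n≤1+n k) k+1≤s s≤n (inj₁ x+1<k) middle-link gap-link)
                  (s≤s z≤n) (arcs-first-gap (ℕ.n≤1+n k) k+1≤s (ℕ.≤-trans (ℕ.n≤1+n (suc x)) x+2≤h) h<k)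
        where
        k = x +ℕ h
        open ArcsMembership (suc x) k (suc k) s
        x<h : x < h
        x<h = ℕ.≤-trans (ℕ.n≤1+n (suc x)) x+2≤h
        h<k : h < k
        h<k = ℕ.+-monoˡ-≤ h 1≤x
        x+1<k : suc x < k
        x+1<k = ℕ.<-trans x+2≤h h<k
        x+1≤k : suc x ≤ k
        x+1≤k = ℕ.<⇒≤ x+1<k
        k<n : k < n
        k<n = ℕ.+-monoˡ-< h x<h
        middle-link : k < suc k → Joins (OutsideMiddle {suc x} {k} {suc k} {s}) (Interval k (suc k))
        middle-link _ = joins-at (ℕ.<-trans x<h h<n) k<n (adj-vertex-chord (ℕ.<-trans x<h h<n) k<n) (inj₁ (ℕ.n<1+n x)) (ℕ.≤-refl , ℕ.n<1+n k)
        gap-link : suc x < k → suc k < s → Joins (Interval (suc x) k) (Interval (suc k) s)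
        gap-link x+1<k′ k+1<s = joins-at (ℕ.<-trans x+1<h h<n) (ℕ.<-≤-trans k+1<s s≤n) (adj-vertex-chord (ℕ.<-trans x+1<h h<n) (ℕ.<-≤-trans k+1<s s≤n))
                                        (ℕ.≤-refl , x+1<k′) (ℕ.≤-refl , k+1<s)
          where
          x+1<h : suc x < h
          x+1<h = x+2≤h

      low-square : ∀ g {k} → lower (coord g) ≡ k → upper (coord g) ≡ suc k → 1 ≤ k → 2 +ℕ k ≤ h → Combination (unit g)
      low-square g {k} l≡ u≡ 1≤k k+2≤h =
        square-combination g l≡ u≡ (arcs 1 k k (2 +ℕ h)) (arcs 1 k (suc k) (2 +ℕ h))
                             (arcs 1 (suc k) (2 +ℕ k) (2 +ℕ h)) (arcs 1 k (2 +ℕ k) (2 +ℕ h))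
          (arcs-second-gap 1≤k ℕ.≤-refl ℕ.≤-refl (ℕ.<-trans k<h h<h+2))
          (arcs-second-gap 1≤k ℕ.≤-refl (ℕ.n≤1+n k) (ℕ.<-trans k+2≤h h<h+2))
          (λ z → grow-middle-right 1 k k (2 +ℕ h) z ℕ.≤-refl)
          (λ z → trans (grow-middle-right 1 (suc k) (suc k) (2 +ℕ h) z ℕ.≤-refl)
                       (cong (_∨ (z ≡ᵇ suc k)) (empty-middle 1 (suc k) k (2 +ℕ h) z)))
          (λ z → grow-middle-right 1 k (suc k) (2 +ℕ h) z (ℕ.n≤1+n k))
          (below-chord 1≤k ℕ.≤-refl (ℕ.<⇒≤ k<h))
          (below-chord 1≤k (ℕ.n≤1+n k) (ℕ.<⇒≤ k+2≤h))
          (below-chord (s≤s z≤n) (ℕ.n≤1+n (suc k)) k+2≤h)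
          (below-chord 1≤k (ℕ.≤-trans (ℕ.n≤1+n k) (ℕ.n≤1+n (suc k))) k+2≤h)
        where
        open ArcsMembership 1 k k (2 +ℕ h)
        k<h : k < h
        k<h = ℕ.≤-trans (ℕ.n≤1+n (suc k)) k+2≤h
        h<h+2 : h < 2 +ℕ h
        h<h+2 = ℕ.≤-trans (ℕ.n<1+n h) (ℕ.n≤1+n (suc h))

      high-square : ∀ g {x} → lower (coord g) ≡ x +ℕ h → upper (coord g) ≡ suc (x +ℕ h) → 1 ≤ x → 2 +ℕ x ≤ h → Combination (unit g)
      high-square g {x} l≡ u≡ 1≤x x+2≤h =
        square-combination g l≡ u≡ (arcs (suc x) (suc x) (suc x) (2 +ℕ k)) (arcs (suc x) k (suc k) (2 +ℕ k))
                             (arcs (suc x) (suc x) (suc x) (suc k)) (arcs (suc x) k (suc k) (suc k))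
          (arcs-second-gap ℕ.≤-refl ℕ.≤-refl x+1≤k (ℕ.≤-trans (ℕ.n<1+n k) (ℕ.n≤1+n (suc k))))
          (arcs-second-gap ℕ.≤-refl ℕ.≤-refl (ℕ.≤-trans x+1≤k (ℕ.n≤1+n k)) (ℕ.n<1+n (suc k)))
          (λ z → trans (grow-middle-right (suc x) k k (2 +ℕ k) z ℕ.≤-refl)
                       (cong (_∨ (z ≡ᵇ k)) (empty-middle (suc x) k (suc x) (2 +ℕ k) z)))
          (grow-right (suc x) (suc x) (suc x) (suc k))
          (grow-right (suc x) k (suc k) (suc k))
          (interval-face (s≤s z≤n) x+1≤h (ℕ.<-trans h<k+1 (ℕ.n<1+n (suc k))) k+2≤n)
          (above-chord 1≤x x+2≤h (ℕ.n≤1+n (suc k)) k+2≤n)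
          (interval-face (s≤s z≤n) x+1≤h h<k+1 (ℕ.<⇒≤ k+2≤n))
          (above-chord 1≤x x+2≤h ℕ.≤-refl (ℕ.<⇒≤ k+2≤n))
        where
        k = x +ℕ h
        open ArcsMembership (suc x) (suc x) (suc x) (2 +ℕ k)
        x+1≤h : suc x ≤ h
        x+1≤h = ℕ.≤-trans (ℕ.n≤1+n (suc x)) x+2≤h
        x+1≤k : suc x ≤ k
        x+1≤k = ℕ.≤-trans x+1≤h (ℕ.m≤n+m h x)
        h<k+1 : h < suc k
        h<k+1 = s≤s (ℕ.m≤n+m h x)
        k+2≤n : 2 +ℕ k ≤ n
        k+2≤n = ℕ.+-monoˡ-≤ h x+2≤h

      chord-square : ∀ g {k} → lower (coord g) ≡ k → upper (coord g) ≡ k +ℕ h → 1 ≤ k → k < h → Combination (unit g)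
      chord-square g {k} l≡ u≡ 1≤k k<h =
        square-combination g l≡ u≡ (arcs k k k (suc (k +ℕ h))) (arcs (suc k) (suc k) (suc k) (suc (k +ℕ h)))
                             (arcs k k k (k +ℕ h)) (arcs (suc k) (suc k) (suc k) (k +ℕ h))
          (arcs-second-gap ℕ.≤-refl ℕ.≤-refl ℕ.≤-refl (s≤s (ℕ.m≤m+n k h)))
          (arcs-second-gap ℕ.≤-refl ℕ.≤-refl (ℕ.m≤m+n k h) (ℕ.n<1+n (k +ℕ h)))
          (λ z → trans (sym (empty-middle (suc k) k (suc k) (suc (k +ℕ h)) z)) (grow-left k k k (suc (k +ℕ h)) z))
          (grow-right k k k (k +ℕ h))
          (grow-right (suc k) (suc k) (suc k) (k +ℕ h))
          (interval-face 1≤k (ℕ.<⇒≤ k<h) (ℕ.<-trans h<k+h (ℕ.n<1+n (k +ℕ h))) k+h<n)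
          (interval-face (s≤s z≤n) k<h (ℕ.<-trans h<k+h (ℕ.n<1+n (k +ℕ h))) k+h<n)
          (interval-face 1≤k (ℕ.<⇒≤ k<h) h<k+h (ℕ.<⇒≤ k+h<n))
          (interval-face (s≤s z≤n) k<h h<k+h (ℕ.<⇒≤ k+h<n))
        where
        open ArcsMembership k k k (suc (k +ℕ h))
        h<k+h : h < k +ℕ h
        h<k+h = ℕ.+-monoˡ-≤ h 1≤k
        k+h<n : k +ℕ h < n
        k+h<n = ℕ.+-monoˡ-< h k<h

      h∸1<n : h ∸ 1 < n
      h∸1<n = ℕ.<-trans (ℕ.n<1+n (h ∸ 1)) h<n

      h+1<n : suc h < n
      h+1<n = ℕ.+-monoˡ-< h {1} {h} (s≤s (s≤s z≤n))

      h<n∸1 : h < n ∸ 1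
      h<n∸1 = subst (h <_) (sym n∸1≡h∸1+h) (ℕ.+-monoˡ-≤ h {1} {h ∸ 1} (s≤s z≤n))

      -- the five edges meeting {0, h}, by increasing coordinate
      special : Fin 5 → Fin m
      special zero                         = first-vertex ↑ˡ h
      special (suc zero)                   = vertex (h ∸ 1) h∸1<n ↑ˡ h
      special (suc (suc zero))             = chord-vertex ↑ˡ h
      special (suc (suc (suc zero)))       = last-vertex ↑ˡ h
      special (suc (suc (suc (suc zero)))) = n ↑ʳ zero

      special-increasing : Increasing special
      special-increasing zero = subst (0 <_) (sym (trans (toℕ-↑ˡ _ h) (toℕ-vertex h∸1<n))) (s≤s z≤n)
      special-increasing (suc zero) =
        subst₂ _<_ (sym (trans (toℕ-↑ˡ _ h) (toℕ-vertex h∸1<n))) (sym (trans (toℕ-↑ˡ _ h) (toℕ-vertex h<n))) (ℕ.n<1+n (h ∸ 1))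
      special-increasing (suc (suc zero)) =
        subst₂ _<_ (sym (trans (toℕ-↑ˡ _ h) (toℕ-vertex h<n))) (sym (trans (toℕ-↑ˡ _ h) toℕ-last)) h<n∸1
      special-increasing (suc (suc (suc zero))) =
        subst₂ _<_ (sym (trans (toℕ-↑ˡ _ h) toℕ-last)) (sym (toℕ-↑ʳ n zero)) (ℕ.≤-trans n∸1<n (ℕ.m≤m+n n 0))

      cycle-case : (i : Fin n) → suc (toℕ i) < n → toℕ i ≢ 0 → toℕ i ≢ h ∸ 1 → toℕ i ≢ h → Combination (unit (i ↑ˡ h))
      cycle-case i i+1<n i≢0 i≢h∸1 i≢h = by-position (2 +ℕ toℕ i ℕ.≤? h)
        where
        by-position : Dec (2 +ℕ toℕ i ≤ h) → Combination (unit (i ↑ˡ h))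
        by-position (yes i+2≤h) =
          low-square (i ↑ˡ h) (proj₁ (cycle-coord i i+1<n)) (proj₂ (cycle-coord i i+1<n)) (ℕ.n≢0⇒n>0 i≢0) i+2≤h
        by-position (no i+2≰h) =
          high-square (i ↑ˡ h) (trans (proj₁ (cycle-coord i i+1<n)) (sym i∸h+h≡i))
                      (trans (proj₂ (cycle-coord i i+1<n)) (cong suc (sym i∸h+h≡i))) (ℕ.m<n⇒0<n∸m h<i) i∸h+2≤h
          where
          h<i : h < toℕ i
          h<i = ℕ.≤∧≢⇒< (ℕ.≤-pred (ℕ.≤∧≢⇒< (ℕ.≤-pred (ℕ.≰⇒> i+2≰h)) (λ h≡i+1 → i≢h∸1 (cong (_∸ 1) (sym h≡i+1)))))
                        (λ h≡i → i≢h (sym h≡i))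
          i∸h+h≡i : (toℕ i ∸ h) +ℕ h ≡ toℕ i
          i∸h+h≡i = ℕ.m∸n+n≡m (ℕ.<⇒≤ h<i)
          i∸h+2≤h : 2 +ℕ (toℕ i ∸ h) ≤ h
          i∸h+2≤h = ℕ.+-cancelʳ-≤ h (2 +ℕ (toℕ i ∸ h)) h (subst (_≤ n) (cong (2 +ℕ_) (sym i∸h+h≡i)) i+1<n)

      unit-from-square : ∀ g → (∀ c → g ≢ special c) → Combination (unit g)
      unit-from-square g = by-view (coord-view g)
        where
        by-view : ∀ {g} → CoordView g → (∀ c → g ≢ special c) → Combination (unit g)
        by-view (cycle i i+1<n) ordinary = cycle-case i i+1<n
          (λ i≡0 → ordinary zero (cong (_↑ˡ h) (toℕ-injective (trans i≡0 (sym toℕ-first)))))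
          (λ i≡h∸1 → ordinary (suc zero) (cong (_↑ˡ h) (toℕ-injective (trans i≡h∸1 (sym (toℕ-vertex h∸1<n))))))
          (λ i≡h → ordinary (suc (suc zero)) (cong (_↑ˡ h) (toℕ-injective (trans i≡h (sym (toℕ-vertex h<n))))))
        by-view (wrap i i≡n∸1) ordinary =
          contradiction (cong (_↑ˡ h) (toℕ-injective (trans i≡n∸1 (sym toℕ-last)))) (ordinary (suc (suc (suc zero))))
        by-view (chord j) ordinary = chord-square (n ↑ʳ j) (proj₁ (chord-coord j)) (proj₂ (chord-coord j))
          (ℕ.n≢0⇒n>0 (λ j≡0 → ordinary (suc (suc (suc (suc zero)))) (cong (n ↑ʳ_) (toℕ-injective {i = j} {j = zero} j≡0))))
          (toℕ<n j)

      special-bond : Fin 5 → FaceBond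
      special-bond zero                         = Arcs 1 1 1 n , interval-face (s≤s z≤n) (s≤s z≤n) h<n ℕ.≤-refl
      special-bond (suc zero)                   = Arcs 2 2 2 n , interval-face (s≤s z≤n) (s≤s (s≤s z≤n)) h<n ℕ.≤-refl
      special-bond (suc (suc zero))             = Arcs h h h (n ∸ 1) , interval-face (s≤s z≤n) ℕ.≤-refl h<n∸1 (ℕ.<⇒≤ n∸1<n)
      special-bond (suc (suc (suc zero)))       = Arcs 2 2 2 (suc h) , interval-face (s≤s z≤n) (s≤s (s≤s z≤n)) (ℕ.n<1+n h) h<n
      special-bond (suc (suc (suc (suc zero)))) = Arcs 2 2 2 (2 +ℕ h) , interval-face (s≤s z≤n) (s≤s (s≤s z≤n)) (ℕ.<-trans (ℕ.n<1+n h) (ℕ.n<1+n (suc h))) h+1<n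

      row-order : Fin 5 → Fin 5
      row-order zero                         = zero
      row-order (suc zero)                   = suc (suc (suc zero))
      row-order (suc (suc zero))             = suc zero
      row-order (suc (suc (suc zero)))       = suc (suc zero)
      row-order (suc (suc (suc (suc zero)))) = suc (suc (suc (suc zero)))

      ends₀ : lower (coord (special zero)) ≡ 0 × upper (coord (special zero)) ≡ 1
      ends₀ = cycle-coord first-vertex (s≤s (s≤s z≤n))

      ends₁ : lower (coord (special (suc zero))) ≡ h ∸ 1 × upper (coord (special (suc zero))) ≡ h
      ends₁ = trans (proj₁ (cycle-coord v v+1<n)) (toℕ-vertex h∸1<n) , trans (proj₂ (cycle-coord v v+1<n)) (cong suc (toℕ-vertex h∸1<n))
        where
        v = vertex (h ∸ 1) h∸1<n
        v+1<n : suc (toℕ v) < n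
        v+1<n = subst (λ x → suc x < n) (sym (toℕ-vertex h∸1<n)) h<n

      ends₂ : lower (coord (special (suc (suc zero)))) ≡ h × upper (coord (special (suc (suc zero)))) ≡ suc h
      ends₂ = trans (proj₁ (cycle-coord chord-vertex v+1<n)) (toℕ-vertex h<n) , trans (proj₂ (cycle-coord chord-vertex v+1<n)) (cong suc (toℕ-vertex h<n))
        where
        v+1<n : suc (toℕ chord-vertex) < n
        v+1<n = subst (λ x → suc x < n) (sym (toℕ-vertex h<n)) h+1<n

      ends₃ : lower (coord (special (suc (suc (suc zero))))) ≡ 0 × upper (coord (special (suc (suc (suc zero))))) ≡ n ∸ 1
      ends₃ = wrap-coord last-vertex toℕ-last

      ends₄ : lower (coord (special (suc (suc (suc (suc zero)))))) ≡ 0 × upper (coord (special (suc (suc (suc (suc zero)))))) ≡ h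
      ends₄ = chord-coord zero

      triangular : LowerUnitriangular (λ c i → vec (special-bond i) (special (row-order c)))
      triangular =
        cut-at (arcs 1 1 1 n) (special zero) (proj₁ ends₀) (proj₂ ends₀) (I.arcs-left (s≤s z≤n)) (I.arcs-second-gap ℕ.≤-refl ℕ.≤-refl ℕ.≤-refl (s≤s (s≤s z≤n))) ,
        (λ { zero → cut-at (arcs 2 2 2 n) (special zero) (proj₁ ends₀) (proj₂ ends₀) (T.arcs-left (s≤s z≤n)) (T.arcs-left (s≤s (s≤s z≤n)))
           ; (suc zero) → cut-at (arcs h h h (n ∸ 1)) (special zero) (proj₁ ends₀) (proj₂ ends₀) (H.arcs-left (s≤s z≤n)) (H.arcs-left (s≤s (s≤s z≤n)))
           ; (suc (suc zero)) → cut-at (arcs 2 2 2 (suc h)) (special zero) (proj₁ ends₀) (proj₂ ends₀) (P.arcs-left (s≤s z≤n)) (P.arcs-left (s≤s (s≤s z≤n)))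
           ; (suc (suc (suc zero))) → cut-at (arcs 2 2 2 (2 +ℕ h)) (special zero) (proj₁ ends₀) (proj₂ ends₀) (Q.arcs-left (s≤s z≤n)) (Q.arcs-left (s≤s (s≤s z≤n))) }) ,
        ( cut-at (arcs 2 2 2 n) (special (suc (suc (suc zero)))) (proj₁ ends₃) (proj₂ ends₃) (T.arcs-left (s≤s z≤n)) (T.arcs-second-gap ℕ.≤-refl ℕ.≤-refl 2≤n∸1 n∸1<n) ,
          (λ { zero → cut-at (arcs h h h (n ∸ 1)) (special (suc (suc (suc zero)))) (proj₁ ends₃) (proj₂ ends₃) (H.arcs-left (s≤s z≤n)) (H.arcs-right ℕ.≤-refl)
             ; (suc zero) → cut-at (arcs 2 2 2 (suc h)) (special (suc (suc (suc zero)))) (proj₁ ends₃) (proj₂ ends₃) (P.arcs-left (s≤s z≤n)) (P.arcs-right (ℕ.≤-pred h+1<n))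
             ; (suc (suc zero)) → cut-at (arcs 2 2 2 (2 +ℕ h)) (special (suc (suc (suc zero)))) (proj₁ ends₃) (proj₂ ends₃) (Q.arcs-left (s≤s z≤n)) (Q.arcs-right h+2≤n∸1) }) ,
          ( cut-at (arcs h h h (n ∸ 1)) (special (suc zero)) (proj₁ ends₁) (proj₂ ends₁) (H.arcs-left (ℕ.n<1+n (h ∸ 1))) (H.arcs-second-gap ℕ.≤-refl ℕ.≤-refl ℕ.≤-refl h<n∸1) ,
            (λ { zero → cut-at (arcs 2 2 2 (suc h)) (special (suc zero)) (proj₁ ends₁) (proj₂ ends₁) (P.arcs-second-gap ℕ.≤-refl ℕ.≤-refl 2≤h∸1 (ℕ.<-trans (ℕ.n<1+n (h ∸ 1)) (ℕ.n<1+n h))) (P.arcs-second-gap ℕ.≤-refl ℕ.≤-refl 2≤h (ℕ.n<1+n h))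
               ; (suc zero) → cut-at (arcs 2 2 2 (2 +ℕ h)) (special (suc zero)) (proj₁ ends₁) (proj₂ ends₁) (Q.arcs-second-gap ℕ.≤-refl ℕ.≤-refl 2≤h∸1 (ℕ.<-trans (ℕ.n<1+n (h ∸ 1)) h<h+2)) (Q.arcs-second-gap ℕ.≤-refl ℕ.≤-refl 2≤h h<h+2) }) ,
            ( cut-at (arcs 2 2 2 (suc h)) (special (suc (suc zero))) (proj₁ ends₂) (proj₂ ends₂) (P.arcs-second-gap ℕ.≤-refl ℕ.≤-refl 2≤h (ℕ.n<1+n h)) (P.arcs-right ℕ.≤-refl) ,
              (λ { zero → cut-at (arcs 2 2 2 (2 +ℕ h)) (special (suc (suc zero))) (proj₁ ends₂) (proj₂ ends₂) (Q.arcs-second-gap ℕ.≤-refl ℕ.≤-refl 2≤h h<h+2) (Q.arcs-second-gap ℕ.≤-refl ℕ.≤-refl (ℕ.≤-trans 2≤h (ℕ.n≤1+n h)) (ℕ.n<1+n (suc h))) }) ,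
              ( cut-at (arcs 2 2 2 (2 +ℕ h)) (special (suc (suc (suc (suc zero))))) (proj₁ ends₄) (proj₂ ends₄) (Q.arcs-left (s≤s z≤n)) (Q.arcs-second-gap ℕ.≤-refl ℕ.≤-refl 2≤h h<h+2) ,
                (λ ()) , tt ) ) ) )
        where
        module I = ArcsMembership 1 1 1 n
        module T = ArcsMembership 2 2 2 n
        module H = ArcsMembership h h h (n ∸ 1)
        module P = ArcsMembership 2 2 2 (suc h)
        module Q = ArcsMembership 2 2 2 (2 +ℕ h)
        2≤h : 2 ≤ h
        2≤h = s≤s (s≤s z≤n)
        2≤h∸1 : 2 ≤ h ∸ 1
        2≤h∸1 = s≤s (s≤s z≤n)
        h<h+2 : h < 2 +ℕ h
        h<h+2 = ℕ.<-trans (ℕ.n<1+n h) (ℕ.n<1+n (suc h))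
        h+2≤n∸1 : 2 +ℕ h ≤ n ∸ 1
        h+2≤n∸1 = subst (2 +ℕ h ≤_) (sym n∸1≡h∸1+h) (ℕ.+-monoˡ-≤ h {2} {h ∸ 1} 2≤h∸1)
        2≤n∸1 : 2 ≤ n ∸ 1
        2≤n∸1 = ℕ.≤-trans 2≤h (ℕ.<⇒≤ h<n∸1)

      off-face-bond : Σ (Subset n) λ S → IsBond S × (S first-vertex xor S chord-vertex) ≡ false
      off-face-bond = Arcs (suc h) (suc h) (suc h) n , interval-bond (s≤s z≤n) h+1<n ℕ.≤-refl ,
        cong₂ _xor_ (ArcsMembership.arcs-left (suc h) (suc h) (suc h) n (s≤s z≤n))
                    (trans (cong (arcs (suc h) (suc h) (suc h) n) (toℕ-vertex h<n)) (ArcsMembership.arcs-left (suc h) (suc h) (suc h) n (ℕ.n<1+n h)))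

    chord-certificate : FacetCertificate
    chord-certificate = certificate special special-increasing special-bond row-order triangular unit-from-square off-face-bond

  open WrapEdge using (wrap-certificate)
  open ChordEdge using (chord-vertex; chord-certificate)

  open Face using (FacetCertificate; module FacetCertificate)

  module _ {a b : Fin n} where

    swap-certificate : FacetCertificate a b → FacetCertificate b a
    swap-certificate cert = record
      { face-bond   = λ i → proj₁ (face-bond i) , proj₁ (proj₂ (face-bond i)) , trans (xor-comm (proj₁ (face-bond i) b) (proj₁ (face-bond i) a)) (proj₂ (proj₂ (face-bond i)))
      ; independent = independent
      ; off-face    = proj₁ off-face , proj₁ (proj₂ off-face) , trans (xor-comm (proj₁ off-face b) (proj₁ off-face a)) (proj₂ (proj₂ off-face))
      }
      where open FacetCertificate cert

  module Transport (σ σ⁻¹ : Fin n → Fin n) (σ⁻¹∘σ : ∀ u → σ⁻¹ (σ u) ≡ u) (σ∘σ⁻¹ : ∀ u → σ (σ⁻¹ u) ≡ u)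
                   (σ-adjacent : ∀ {u w} → Adj n u w → Adj n (σ u) (σ w)) where

    image : Subset n → Subset n
    image S = S ∘ σ⁻¹

    private
      ∈image : ∀ {S} u → T (S u) → T (image S (σ u))
      ∈image {S} u u∈S = subst (λ v → T (S v)) (sym (σ⁻¹∘σ u)) u∈S

      image-reach : ∀ {S u v} → Reach S u v → Reach (image S) (σ u) (σ v)
      image-reach     here                     = here
      image-reach {S} (step {w = w} u~w w∈S r) = step (σ-adjacent u~w) (∈image {S} w w∈S) (image-reach r)

      image-connected : ∀ {S} → Connected S → Connected (image S)
      image-connected {S} ((u , u∈S) , reach) =
        (σ u , ∈image {S} u u∈S) ,
        λ u′ v′ u′∈ v′∈ → subst₂ (Reach (image S)) (σ∘σ⁻¹ u′) (σ∘σ⁻¹ v′) (image-reach (reach (σ⁻¹ u′) (σ⁻¹ v′) u′∈ v′∈))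

    image-bond : ∀ {S} → IsBond S → IsBond (image S)
    image-bond (S-connected , complement-connected) = image-connected S-connected , image-connected complement-connected

    image-at : ∀ S u → image S (σ u) ≡ S u
    image-at S u = cong S (σ⁻¹∘σ u)

    image-edge : Edge n → Edge n
    image-edge ((u , w) , u<w , u~w) with ℕ.<-cmp (toℕ (σ u)) (toℕ (σ w))
    ... | tri< σu<σw _ _ = (σ u , σ w) , σu<σw , σ-adjacent u~w
    ... | tri≈ _ σu≡σw _ = contradiction (cong toℕ (trans (sym (σ⁻¹∘σ u)) (trans (cong σ⁻¹ (toℕ-injective σu≡σw)) (σ⁻¹∘σ w))))
                                         (ℕ.<⇒≢ u<w)
    ... | tri> _ _ σw<σu = (σ w , σ u) , σw<σu , Adj-sym (σ-adjacent u~w)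

    cutVec-image : ∀ S e → cutVec (image S) (image-edge e) ≡ cutVec S e
    cutVec-image S ((u , w) , u<w , u~w) with ℕ.<-cmp (toℕ (σ u)) (toℕ (σ w))
    ... | tri< σu<σw _ _ = begin
      cutVec (image S) ((σ u , σ w) , σu<σw , σ-adjacent u~w) ≡⟨ cutVec≡toQ (image S) ((σ u , σ w) , σu<σw , σ-adjacent u~w) ⟩
      toQ (image S (σ u) xor image S (σ w))                  ≡⟨ cong₂ (λ p q → toQ (p xor q)) (image-at S u) (image-at S w) ⟩
      toQ (S u xor S w)                                      ≡⟨ sym (cutVec≡toQ S ((u , w) , u<w , u~w)) ⟩
      cutVec S ((u , w) , u<w , u~w)                         ∎
      where open ≡-Reasoning
    ... | tri≈ _ σu≡σw _ = contradiction (cong toℕ (trans (sym (σ⁻¹∘σ u)) (trans (cong σ⁻¹ (toℕ-injective σu≡σw)) (σ⁻¹∘σ w))))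
                                         (ℕ.<⇒≢ u<w)
    ... | tri> _ _ σw<σu = begin
      cutVec (image S) ((σ w , σ u) , σw<σu , Adj-sym (σ-adjacent u~w)) ≡⟨ cutVec≡toQ (image S) ((σ w , σ u) , σw<σu , Adj-sym (σ-adjacent u~w)) ⟩
      toQ (image S (σ w) xor image S (σ u))                            ≡⟨ cong₂ (λ p q → toQ (p xor q)) (image-at S w) (image-at S u) ⟩
      toQ (S w xor S u)                                                ≡⟨ cong toQ (xor-comm (S w) (S u)) ⟩
      toQ (S u xor S w)                                                ≡⟨ sym (cutVec≡toQ S ((u , w) , u<w , u~w)) ⟩
      cutVec S ((u , w) , u<w , u~w)                                   ∎
      where open ≡-Reasoning

    transport : ∀ {a b} → FacetCertificate a b → FacetCertificate (σ a) (σ b)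
    transport {a} {b} cert = record
      { face-bond   = λ i → image (S i) , image-bond (proj₁ (proj₂ (face-bond i))) ,
                            trans (cong₂ _xor_ (image-at (S i) a) (image-at (S i) b)) (proj₂ (proj₂ (face-bond i)))
      ; independent = λ c c-rel → independent c (λ e →
                        trans (sum-cong-≗ (λ i → cong (c i *_) (sym (cutVec-image (S i) e)))) (c-rel (image-edge e)))
      ; off-face    = image (proj₁ off-face) , image-bond (proj₁ (proj₂ off-face)) ,
                      trans (cong₂ _xor_ (image-at (proj₁ off-face) a) (image-at (proj₁ off-face) b)) (proj₂ (proj₂ off-face))
      }
      where
      open FacetCertificate cert
      S = λ i → proj₁ (face-bond i)

  -- Rotations

  private
    next-by : (i : Fin n) → Dec (suc (toℕ i) < n) → Fin n
    next-by i (yes i+1<n) = vertex (suc (toℕ i)) i+1<n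
    next-by i (no  _)     = first-vertex

  next : Fin n → Fin n
  next i = next-by i (suc (toℕ i) ℕ.<? n)

  previous : Fin n → Fin n
  previous zero    = last-vertex
  previous (suc j) = Fin.inject₁ j

  data NextView (i j : Fin n) : Set where
    step : suc (toℕ i) < n → toℕ j ≡ suc (toℕ i) → NextView i j
    wrap : toℕ i ≡ n ∸ 1 → toℕ j ≡ 0 → NextView i j

  next-view : ∀ i → NextView i (next i)
  next-view i = by-decision (suc (toℕ i) ℕ.<? n)
    where
    by-decision : (d : Dec (suc (toℕ i) < n)) → NextView i (next-by i d)
    by-decision (yes i+1<n) = step i+1<n (toℕ-vertex i+1<n)
    by-decision (no  i+1≮n) = wrap (cong (_∸ 1) (ℕ.≤-antisym (toℕ<n i) (ℕ.≮⇒≥ i+1≮n))) toℕ-first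

  private
    previous-of-suc : ∀ x {t} → toℕ x ≡ suc t → toℕ (previous x) ≡ t
    previous-of-suc (suc j) x≡t+1 = trans (toℕ-inject₁ j) (ℕ.suc-injective x≡t+1)

  previous-next : ∀ i → previous (next i) ≡ i
  previous-next i with next-view i
  ... | step _ next≡i+1 = toℕ-injective (previous-of-suc (next i) next≡i+1)
  ... | wrap i≡n∸1 next≡0 = toℕ-injective (trans (cong (toℕ ∘ previous) (toℕ-injective {j = zero} next≡0)) (trans toℕ-last (sym i≡n∸1)))

  next-previous : ∀ i → next (previous i) ≡ i
  next-previous zero with next-view last-vertex
  ... | step last+1<n _ = contradiction (subst (λ x → suc x < n) toℕ-last last+1<n) (ℕ.<-irrefl refl)
  ... | wrap _ next≡0 = toℕ-injective next≡0
  next-previous (suc j) with next-view (Fin.inject₁ j)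
  ... | step _ next≡ = toℕ-injective (trans next≡ (cong suc (toℕ-inject₁ j)))
  ... | wrap j≡n∸1 _ = contradiction (trans (sym (toℕ-inject₁ j)) j≡n∸1) (ℕ.<⇒≢ (toℕ<n j))

  next-adjacent : ∀ {u w} → Adj n u w → Adj n (next u) (next w)
  next-adjacent (inj₁ u→w) = next-arc u→w
    where
    next-arc : ∀ {u w} → Arc n u w → Adj n (next u) (next w)
    next-arc {u} {w} (inj₁ w≡u+1) with next-view u | next-view w
    ... | step _ u′≡ | step _ w′≡ = adj-suc (trans w′≡ (cong suc (trans w≡u+1 (sym u′≡))))
    ... | step _ u′≡ | wrap w≡n∸1 w′≡0 = adj-wrap (trans u′≡ (trans (sym w≡u+1) w≡n∸1)) w′≡0
    ... | wrap u≡n∸1 _ | _ = contradiction (subst (_< n) (trans w≡u+1 (cong suc u≡n∸1)) (toℕ<n w)) (ℕ.<-irrefl refl)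
    next-arc {u} {w} (inj₂ (inj₁ (u≡n∸1 , w≡0))) with next-view u | next-view w
    ... | wrap _ u′≡0 | step _ w′≡ = adj-suc (trans w′≡ (cong suc (trans w≡0 (sym u′≡0))))
    ... | step u+1<n _ | _ = contradiction (subst (λ x → suc x < n) u≡n∸1 u+1<n) (ℕ.<-irrefl refl)
    ... | wrap _ _ | wrap w≡n∸1 _ = contradiction (trans (sym w≡0) w≡n∸1) λ ()
    next-arc {u} {w} (inj₂ (inj₂ w≡u+n/2)) with next-view u | next-view w
    ... | step _ u′≡ | step _ w′≡ = adj-chord (trans w′≡ (trans (cong suc w≡u+h) (cong (_+ℕ h) (sym u′≡))))
      where
      w≡u+h : toℕ w ≡ toℕ u +ℕ h
      w≡u+h = trans w≡u+n/2 (cong (toℕ u +ℕ_) n/2≡h)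
    ... | step _ u′≡ | wrap w≡n∸1 w′≡0 = Adj-sym (adj-chord (trans (trans u′≡ (cong suc u≡h∸1)) (cong (_+ℕ h) (sym w′≡0))))
      where
      u≡h∸1 : toℕ u ≡ h ∸ 1
      u≡h∸1 = ℕ.+-cancelʳ-≡ h (toℕ u) (h ∸ 1) (trans (sym (trans w≡u+n/2 (cong (toℕ u +ℕ_) n/2≡h))) (trans w≡n∸1 n∸1≡h∸1+h))
    ... | wrap u≡n∸1 _ | _ = contradiction (toℕ<n w) (ℕ.≤⇒≯ (subst (n ≤_) (sym w≡n∸1+h) (ℕ.m<m+n (n ∸ 1) (s≤s z≤n))))
      where
      w≡n∸1+h : toℕ w ≡ (n ∸ 1) +ℕ h
      w≡n∸1+h = trans w≡u+n/2 (cong₂ _+ℕ_ u≡n∸1 n/2≡h)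
  next-adjacent (inj₂ w→u) = Adj-sym (next-adjacent (inj₁ w→u))

  rotate : ℕ → Fin n → Fin n
  rotate zero    = λ u → u
  rotate (suc t) = next ∘ rotate t

  toℕ-rotate : ∀ t x → toℕ x +ℕ t < n → toℕ (rotate t x) ≡ toℕ x +ℕ t
  toℕ-rotate zero    x _ = sym (ℕ.+-identityʳ (toℕ x))
  toℕ-rotate (suc t) x x+t+1<n = after (next-view (rotate t x))
    where
    x+t<n : toℕ x +ℕ t < n
    x+t<n = ℕ.<-trans (subst (toℕ x +ℕ t <_) (sym (ℕ.+-suc (toℕ x) t)) (ℕ.n<1+n _)) x+t+1<n
    after : NextView (rotate t x) (next (rotate t x)) → toℕ (next (rotate t x)) ≡ toℕ x +ℕ suc t
    after (step _ next≡) = trans next≡ (trans (cong suc (toℕ-rotate t x x+t<n)) (sym (ℕ.+-suc (toℕ x) t)))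
    after (wrap rot≡n∸1 _) =
      contradiction (subst (_< n) (trans (ℕ.+-suc (toℕ x) t) (cong suc (trans (sym (toℕ-rotate t x x+t<n)) rot≡n∸1))) x+t+1<n)
                    (ℕ.<-irrefl refl)

  transport-next : ∀ {a b} → FacetCertificate a b → FacetCertificate (next a) (next b)
  transport-next = Transport.transport next previous previous-next next-previous next-adjacent

  rotate-certificate : ∀ t {a b} → FacetCertificate a b → FacetCertificate (rotate t a) (rotate t b)
  rotate-certificate zero    cert = cert
  rotate-certificate (suc t) cert = transport-next (rotate-certificate t cert)

  private
    shift-certificate : ∀ {a₀ b₀ a b} t → toℕ a₀ +ℕ t ≡ toℕ a → toℕ b₀ +ℕ t ≡ toℕ b →
                        FacetCertificate a₀ b₀ → FacetCertificate a b
    shift-certificate {a₀} {b₀} {a} {b} t a₀+t≡a b₀+t≡b cert =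
      subst₂ FacetCertificate (toℕ-injective (trans (toℕ-rotate t a₀ (subst (_< n) (sym a₀+t≡a) (toℕ<n a))) a₀+t≡a))
                              (toℕ-injective (trans (toℕ-rotate t b₀ (subst (_< n) (sym b₀+t≡b) (toℕ<n b))) b₀+t≡b))
                              (rotate-certificate t cert)

    next-last≡0 : toℕ (next last-vertex) ≡ 0
    next-last≡0 with next-view last-vertex
    ... | step last+1<n _ = contradiction (subst (λ x → suc x < n) toℕ-last last+1<n) (ℕ.<-irrefl refl)
    ... | wrap _ next≡0   = next≡0

    next-first≡1 : toℕ (next first-vertex) ≡ 1
    next-first≡1 with next-view first-vertex
    ... | step _ next≡       = trans next≡ (cong suc toℕ-first)
    ... | wrap first≡n∸1 _ = contradiction (trans (sym toℕ-first) first≡n∸1) λ ()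

  certificate-for : (e : Edge n) → FacetCertificate (proj₁ (proj₁ e)) (proj₂ (proj₁ e))
  certificate-for ((a , b) , a<b , inj₁ (inj₁ b≡a+1)) =
    shift-certificate (toℕ a) (cong (_+ℕ toℕ a) next-last≡0) (trans (cong (_+ℕ toℕ a) next-first≡1) (sym b≡a+1))
      (transport-next (swap-certificate wrap-certificate))
  certificate-for ((a , b) , a<b , inj₁ (inj₂ (inj₂ b≡a+n/2))) =
    shift-certificate (toℕ a) (cong (_+ℕ toℕ a) toℕ-first)
      (trans (cong (_+ℕ toℕ a) (toℕ-vertex h<n)) (trans (ℕ.+-comm h (toℕ a)) (sym (trans b≡a+n/2 (cong (toℕ a +ℕ_) n/2≡h)))))
      chord-certificate
  certificate-for ((a , b) , a<b , inj₂ (inj₂ (inj₁ (b≡n∸1 , a≡0)))) =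
    subst₂ FacetCertificate (toℕ-injective (trans toℕ-first (sym a≡0))) (toℕ-injective (trans toℕ-last (sym b≡n∸1))) wrap-certificate
  certificate-for ((a , b) , a<b , inj₁ (inj₂ (inj₁ (_ , b≡0)))) = contradiction (subst (toℕ a <_) b≡0 a<b) λ ()
  certificate-for ((a , b) , a<b , inj₂ (inj₁ a≡b+1)) = contradiction (subst (toℕ b <_) (sym a≡b+1) (ℕ.n<1+n (toℕ b))) (ℕ.<-asym a<b)
  certificate-for ((a , b) , a<b , inj₂ (inj₂ (inj₂ a≡b+n/2))) =
    contradiction (subst (toℕ b <_) (sym (trans a≡b+n/2 (cong (toℕ b +ℕ_) n/2≡h))) (ℕ.m<m+n (toℕ b) (s≤s z≤n))) (ℕ.<-asym a<b)

  private
    toQ≤1 : ∀ b → toQ b ≤ℚ 1ℚ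
    toQ≤1 true  = ℚ.≤-refl
    toQ≤1 false = ℚ.≤ᵇ⇒≤ tt

    cut-of-pair : ∀ S (e : Edge n) {β} → (S (proj₁ (proj₁ e)) xor S (proj₂ (proj₁ e))) ≡ β → cutVec S e ≡ toQ β
    cut-of-pair S e refl = cutVec≡toQ S e

    bond-vector : ∀ S → IsBond S → IsBondVec n (cutVec S)
    bond-vector S (S-connected , complement-connected) = S , S-connected , complement-connected , λ _ → refl

    5≤m : 5 ≤ m
    5≤m = ℕ.≤-trans (ℕ.n≤1+n 5) (ℕ.≤-trans (ℕ.+-mono-≤ {3} {h} {3} {h} (s≤s (s≤s (s≤s z≤n))) (s≤s (s≤s (s≤s z≤n)))) (ℕ.m≤m+n n h))

    bond-vector-by-coordinates : ∀ {x} → IsBondVec n x → ∀ f → x f ≡ x (coord (proj₁ (coord-surjective f)))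
    bond-vector-by-coordinates (S , _ , _ , x≡cut) f =
      trans (x≡cut f) (trans (cutVec-same-ends S {f} {coord (proj₁ (coord-surjective f))} (sym l≡ , sym u≡)) (sym (x≡cut (coord (proj₁ (coord-surjective f))))))
      where
      l≡ = proj₁ (proj₂ (coord-surjective f))
      u≡ = proj₂ (proj₂ (coord-surjective f))

  facet-defining : (e : Edge n) → FacetDefining-xe≤1 n e
  facet-defining e = valid , pred m ,
    facet-dimensions (ℕ.m+[n∸m]≡n 5≤m)
      (λ i → cutVec (proj₁ (face-bond i)))
      (λ i → bond-vector (proj₁ (face-bond i)) (proj₁ (proj₂ (face-bond i))) , cut-of-pair (proj₁ (face-bond i)) e (proj₂ (proj₂ (face-bond i))))
      independent
      (cutVec (proj₁ off-face)) (bond-vector (proj₁ off-face) (proj₁ (proj₂ off-face))) (cut-of-pair (proj₁ off-face) e (proj₂ (proj₂ off-face)))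
    where
    open FacetCertificate (certificate-for e)
    open Facet (IsBondVec n) e {pred m} coord (λ f → proj₁ (coord-surjective f)) (λ x∈P → bond-vector-by-coordinates x∈P)
    valid : ∀ x → IsBondVec n x → x e ≤ℚ 1ℚ
    valid x (S , _ , _ , x≡cut) = subst (_≤ℚ 1ℚ) (sym (trans (x≡cut e) (cutVec≡toQ S e))) (toQ≤1 (S (proj₁ (proj₁ e)) xor S (proj₂ (proj₁ e))))

theorem7p6 : (n : ℕ) → 2 ∣ n → 6 ≤ n → (e : Edge n) → FacetDefining-xe≤1 n e
theorem7p6 n (divides q n≡q*2) 6≤n =
  subst (λ n → (e : Edge n) → FacetDefining-xe≤1 n e) (sym n≡h+h) (Wagner.facet-defining (q ∸ 3))
  where
  q≡3+[q∸3] : q ≡ 3 +ℕ (q ∸ 3)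
  q≡3+[q∸3] = sym (ℕ.m+[n∸m]≡n (ℕ.*-cancelʳ-≤ 3 q 2 (subst (6 ≤_) n≡q*2 6≤n)))
  n≡h+h : n ≡ (3 +ℕ (q ∸ 3)) +ℕ (3 +ℕ (q ∸ 3))
  n≡h+h = trans n≡q*2 (trans (ℕ.*-comm q 2) (trans (cong (q +ℕ_) (ℕ.+-identityʳ q)) (cong₂ _+ℕ_ q≡3+[q∸3] q≡3+[q∸3])))
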